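{- Let $F_{r^2,o}(x,y,q)$ be the generating series, by width ($x$), height ($y$) and area ($q$), of convex polyominoes of odd width invariant under rotation by $180^\circ$. Let $D(s,x,y,q)$ be the generating series of directed convex polyominoes by height of the leftmost column ($s$), width ($x$), height ($y$) and area ($q$), and let $T(x,y,q)$ be the generating series of stack polyominoes by width, height and area. Then $$F_{r^2,o}(x,y,q)=\frac{2}{x}D\big(\tfrac{1}{yq},x^2,y^2,q^2\big)-\frac1x T\big(x^2,\tfrac yq,q^2\big).$$
   Context: A polyomino is a finite edge-connected union of unit cells of the square lattice, up to translation; convex means its intersection with every horizontal and vertical line is connected. A directed convex polyomino is a convex polyomino containing a cell (the source) from which every cell can be reached by a path of cells of the polyomino using only North and East unit steps. A stack polyomino is a pile of nonempty horizontal rows at consecutive heights, all starting at the same leftmost column, whose lengths read from bottom to top are weakly increasing then weakly decreasing. Invariance under rotation means the rotation maps the polyomino to a translate of itself. -}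

module Defs where

open import Data.Nat using (ℕ; zero; suc; _+_; _*_; _∸_; _≤_; _<_; _⊔_; _≟_)
open import Data.Product using (Σ; ∃; _×_; _,_; proj₁; proj₂)
open import Data.Sum using (_⊎_)
open import Data.List using (List; []; map; foldr; length; filter)
open import Data.List.Membership.Propositional using (_∈_)
open import Data.List.Relation.Unary.Linked using (Linked)
open import Data.List.Relation.Unary.Unique.Propositional using (Unique)
open import Relation.Binary.PropositionalEquality using (_≡_)
open import Relation.Nullary using (¬_)
open import Function.Bundles using (_⇔_)

-- A cell (x , y) of the square lattice: x = column, y = row.
-- Polyominoes are taken up to translation by normalising them so that the
-- minimal column and minimal row are both 0 (hence ℕ coordinates suffice).
Cell : Set
Cell = ℕ × ℕ

-- strict lexicographic order, used to give each finite cell set a unique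
-- representative (a strictly sorted list)
_<ᶜ_ : Cell → Cell → Set
(a , b) <ᶜ (c , d) = (a < c) ⊎ ((a ≡ c) × (b < d))

data Adj : Cell → Cell → Set where
  east  : ∀ {x y} → Adj (x , y) (suc x , y)
  west  : ∀ {x y} → Adj (suc x , y) (x , y)
  north : ∀ {x y} → Adj (x , y) (x , suc y)
  south : ∀ {x y} → Adj (x , suc y) (x , y)

data Path (S : List Cell) : Cell → Cell → Set where
  nil  : ∀ {c} → c ∈ S → Path S c c
  cons : ∀ {c d e} → c ∈ S → Adj c d → Path S d e → Path S c e

data NEPath (S : List Cell) : Cell → Cell → Set where
  nil   : ∀ {c} → c ∈ S → NEPath S c c
  stepE : ∀ {x y e} → (x , y) ∈ S → NEPath S (suc x , y) e → NEPath S (x , y) e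
  stepN : ∀ {x y e} → (x , y) ∈ S → NEPath S (x , suc y) e → NEPath S (x , y) e

record IsPolyomino (S : List Cell) : Set where
  field
    sorted        : Linked _<ᶜ_ S
    nonempty      : ¬ (S ≡ [])
    leftAligned   : ∃ λ y → (0 , y) ∈ S
    bottomAligned : ∃ λ x → (x , 0) ∈ S
    connected     : ∀ {c d} → c ∈ S → d ∈ S → Path S c d

Convex : List Cell → Set
Convex S =
  (∀ y a b c → (a , y) ∈ S → (c , y) ∈ S → a ≤ b → b ≤ c → (b , y) ∈ S) ×
  (∀ x a b c → (x , a) ∈ S → (x , c) ∈ S → a ≤ b → b ≤ c → (x , b) ∈ S)

IsConvexPolyomino : List Cell → Set
IsConvexPolyomino S = IsPolyomino S × Convex S

Directed : List Cell → Set
Directed S = Σ Cell λ s → s ∈ S × (∀ c → c ∈ S → NEPath S s c)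

IsDirectedConvex : List Cell → Set
IsDirectedConvex S = IsConvexPolyomino S × Directed S

IsStack : List Cell → Set
IsStack S = IsPolyomino S × (Σ ℕ λ h → Σ (ℕ → ℕ) λ r → Σ ℕ λ k →
    (∀ x y → ((x , y) ∈ S) ⇔ ((y < h) × (x < r y))) ×
    (∀ y → y < h → 0 < r y) ×
    (∀ i j → i ≤ j → j ≤ k → r i ≤ r j) ×
    (∀ i j → k ≤ i → i ≤ j → j < h → r j ≤ r i))

Odd : ℕ → Set
Odd n = ∃ λ k → n ≡ suc (2 * k)

width : List Cell → ℕ
width S = suc (foldr _⊔_ 0 (map proj₁ S))

height : List Cell → ℕ
height S = suc (foldr _⊔_ 0 (map proj₂ S))

area : List Cell → ℕ
area S = length S

leftColHeight : List Cell → ℕ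
leftColHeight S = length (filter (λ c → proj₁ c ≟ 0) S)

-- rotation by 180° of the bounding box, followed by normalising translation
rot180 : List Cell → Cell → Cell
rot180 S (x , y) = (width S ∸ 1 ∸ x , height S ∸ 1 ∸ y)

-- the rotated polyomino is a translate of (here: equal to, after normalising) itself
RotInvariant : List Cell → Set
RotInvariant S = ∀ c → (c ∈ S) ⇔ (c ∈ map (rot180 S) S)

Count : (List Cell → Set) → ℕ → Set
Count P n = Σ (List (List Cell)) λ L →
  (length L ≡ n) × Unique L × (∀ S → (S ∈ L) ⇔ P S)

-- [x^W y^H q^A] F_{r²,o}(x,y,q)
FClass : ℕ → ℕ → ℕ → List Cell → Set
FClass W H A S = IsConvexPolyomino S × RotInvariant S × Odd (width S) ×
  (width S ≡ W) × (height S ≡ H) × (area S ≡ A)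

-- [x^n y^H q^A] D(1/(yq), x², y², q²): a directed convex polyomino with width w,
-- height h, area a, leftmost column height c contributes x^(2w) y^(2h-c) q^(2a-c)
DClass : ℕ → ℕ → ℕ → List Cell → Set
DClass n H A S = IsDirectedConvex S × (2 * width S ≡ n) ×
  (2 * height S ≡ H + leftColHeight S) × (2 * area S ≡ A + leftColHeight S)

-- [x^n y^H q^A] T(x², y/q, q²): a stack with width w, height h, area a
-- contributes x^(2w) y^h q^(2a-h)
TClass : ℕ → ℕ → ℕ → List Cell → Set
TClass n H A S = IsStack S × (2 * width S ≡ n) ×
  (height S ≡ H) × (2 * area S ≡ A + height S)

{-# OPTIONS --safe #-}

-- Cut a rotation-invariant convex polyomino X of odd width 2m+1 along its middle column, whose
-- lowest cell is (m , d). If no cell right of that column lies below row d, the right half, moved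
-- to the origin, is a directed convex polyomino S (source at the origin), and X is S glued to its
-- 180° rotation along the left column of S. If S has width w, height h, area a and left column
-- height c, then X has width 2w − 1, height 2h − c and area 2a − c: this is the substitution
-- D(1/(yq), x², y², q²)/x. Otherwise the upside-down reflection of X is of the first kind with
-- d > 0, i.e. c < h: S is not a stack. Gluing is injective and the two kinds never coincide, so
-- #F = #D + #(D ∖ T) = 2 #D − #T, the stacks being exactly the S with c = h, for which the weight
-- of D becomes that of T(x², y/q, q²).
module Submission where

open import Defs
open import Data.Nat using (ℕ; zero; suc; _+_; _*_; _∸_; _≤_; _<_; _⊔_; _≟_; z≤n; s≤s; _≤?_; _<?_)
open import Data.Nat.Properties
open import Data.Product using (Σ; ∃; ∃₂; _×_; _,_; proj₁; proj₂)
open import Data.Product.Properties using (≡-dec)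
open import Data.Sum using (_⊎_; inj₁; inj₂)
open import Data.Empty using (⊥-elim)
open import Data.Unit using (⊤; tt)
open import Data.Bool using (true; false)
open import Data.List using (List; []; _∷_; [_]; _++_; map; foldr; length; filter; upTo; applyUpTo; cartesianProduct)
open import Data.List.Properties using (length-++; length-map; length-filter; length-applyUpTo)
open import Data.List.Membership.Propositional using (_∈_; find; lose)
open import Data.List.Membership.Propositional.Properties
  using (∈-map⁺; ∈-map⁻; ∈-++⁺ˡ; ∈-++⁺ʳ; ∈-++⁻; ∈-filter⁺; ∈-filter⁻; ∈-applyUpTo⁺; ∈-applyUpTo⁻;
         ∈-upTo⁺; ∈-upTo⁻; ∈-cartesianProduct⁺; ∈-cartesianProduct⁻)
open import Data.List.Membership.Propositional.Properties.WithK using (unique∧set⇒bag)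
open import Data.List.Relation.Binary.BagAndSetEquality using (_∼[_]_; set; ∼bag⇒↭)
open import Data.List.Relation.Binary.Permutation.Propositional.Properties using (↭-length)
open import Data.List.Relation.Unary.Any using (Any; here; there; any?)
open import Data.List.Relation.Unary.Any.Properties using (¬Any[])
open import Data.List.Relation.Unary.All as All using (All; []; _∷_; all?)
import Data.List.Relation.Unary.All.Properties as All
open import Data.List.Relation.Unary.AllPairs as AllPairs using (AllPairs; []; _∷_)
import Data.List.Relation.Unary.AllPairs.Properties as AllPairs
open import Data.List.Relation.Unary.Linked as Linked using (Linked)
import Data.List.Relation.Unary.Linked.Properties as Linked
open import Data.List.Relation.Unary.Unique.Propositional using (Unique)
import Data.List.Relation.Unary.Unique.Propositional.Properties as Unique
open import Relation.Binary using (Transitive; DecidableEquality; tri<; tri≈; tri>)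
open import Relation.Binary.PropositionalEquality
  using (_≡_; _≢_; refl; sym; trans; cong; cong₂; subst; subst₂; module ≡-Reasoning)
open import Relation.Nullary using (¬_; Dec; yes; no; does; ¬?)
open import Relation.Nullary.Decidable using (map′; _×-dec_; _→-dec_)
open import Relation.Unary using (Decidable; _∩_; ∁)
open import Relation.Unary.Properties using (∁?)
open import Function.Base using (_∘_)
open import Function.Bundles using (_⇔_; mk⇔; module Equivalence)

open Equivalence using (to; from)

-- Sorted cell lists and counting

<ᶜ-trans : Transitive _<ᶜ_
<ᶜ-trans (inj₁ p) (inj₁ q) = inj₁ (<-trans p q)
<ᶜ-trans (inj₁ p) (inj₂ (refl , q)) = inj₁ p
<ᶜ-trans (inj₂ (refl , p)) (inj₁ q) = inj₁ q
<ᶜ-trans (inj₂ (refl , p)) (inj₂ (refl , q)) = inj₂ (refl , <-trans p q)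

<ᶜ-irrefl : ∀ {c} → ¬ c <ᶜ c
<ᶜ-irrefl (inj₁ p) = <-irrefl refl p
<ᶜ-irrefl (inj₂ (_ , p)) = <-irrefl refl p

_<ᶜ?_ : ∀ c d → Dec (c <ᶜ d)
(a , b) <ᶜ? (c , d) with a <? c | a ≟ c | b <? d
... | yes a<c | _ | _ = yes (inj₁ a<c)
... | no a≮c | yes a≡c | yes b<d = yes (inj₂ (a≡c , b<d))
... | no a≮c | no a≢c | _ = no λ { (inj₁ a<c) → a≮c a<c ; (inj₂ (a≡c , _)) → a≢c a≡c }
... | no a≮c | _ | no b≮d = no λ { (inj₁ a<c) → a≮c a<c ; (inj₂ (_ , b<d)) → b≮d b<d }

_≟ᶜ_ : DecidableEquality Cell
_≟ᶜ_ = ≡-dec _≟_ _≟_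

open import Data.List.Membership.DecPropositional _≟ᶜ_ using (_∈?_)

Sorted : List Cell → Set
Sorted = Linked _<ᶜ_

Sorted⇒All : ∀ {c S} → Sorted (c ∷ S) → All (c <ᶜ_) S
Sorted⇒All Linked.[-] = []
Sorted⇒All (c<d Linked.∷ sorted) = Linked.Linked⇒All <ᶜ-trans c<d sorted

Sorted⇒Unique : ∀ {S} → Sorted S → Unique S
Sorted⇒Unique sorted = AllPairs.map (λ { c<d refl → <ᶜ-irrefl c<d }) (Linked.Linked⇒AllPairs <ᶜ-trans sorted)

private
  sorted-heads-≡ : ∀ {a b S T} → All (a <ᶜ_) S → All (b <ᶜ_) T → a ∈ b ∷ T → b ∈ a ∷ S → a ≡ b
  sorted-heads-≡ _ _ (here a≡b) _ = a≡b
  sorted-heads-≡ _ _ (there _) (here b≡a) = sym b≡a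
  sorted-heads-≡ a<S b<T (there a∈T) (there b∈S) =
    ⊥-elim (<ᶜ-irrefl (<ᶜ-trans (All.lookup a<S b∈S) (All.lookup b<T a∈T)))

  ∈-tail : ∀ {a c S T} → All (a <ᶜ_) S → c ∈ S → c ∈ a ∷ T → c ∈ T
  ∈-tail a<S c∈S (here refl) = ⊥-elim (<ᶜ-irrefl (All.lookup a<S c∈S))
  ∈-tail _ _ (there c∈T) = c∈T

∈⇒nonempty : ∀ {c : Cell} {L} → c ∈ L → ¬ L ≡ []
∈⇒nonempty c∈L refl = ¬Any[] c∈L

sorted-set⇒≡ : ∀ {S T} → Sorted S → Sorted T → S ∼[ set ] T → S ≡ T
sorted-set⇒≡ {[]} {[]} _ _ _ = refl
sorted-set⇒≡ {[]} {_ ∷ _} _ _ S≈T with () ← from S≈T (here refl)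
sorted-set⇒≡ {_ ∷ _} {[]} _ _ S≈T with () ← to S≈T (here refl)
sorted-set⇒≡ {a ∷ S} {b ∷ T} sS sT S≈T
  with refl ← sorted-heads-≡ (Sorted⇒All sS) (Sorted⇒All sT) (to S≈T (here refl)) (from S≈T (here refl)) =
  cong (a ∷_) (sorted-set⇒≡ (Linked.tail sS) (Linked.tail sT)
    (mk⇔ (λ c∈S → ∈-tail (Sorted⇒All sS) c∈S (to S≈T (there c∈S)))
         (λ c∈T → ∈-tail (Sorted⇒All sT) c∈T (from S≈T (there c∈T)))))

unique-set⇒length-≡ : ∀ {A : Set} {xs ys : List A} → Unique xs → Unique ys → xs ∼[ set ] ys → length xs ≡ length ys
unique-set⇒length-≡ uxs uys xs≈ys = ↭-length (∼bag⇒↭ (unique∧set⇒bag uxs uys xs≈ys))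

unique-map⁺-on : ∀ {A B : Set} {xs : List A} (f : A → B) → Unique xs →
  (∀ {a b} → a ∈ xs → b ∈ xs → f a ≡ f b → a ≡ b) → Unique (map f xs)
unique-map⁺-on {xs = []} f [] _ = []
unique-map⁺-on {xs = x ∷ xs} f (x∉xs ∷ u) inj =
  All.map⁺ (All.tabulate (λ y∈xs fx≡fy → All.lookup x∉xs y∈xs (inj (here refl) (there y∈xs) fx≡fy)))
    ∷ unique-map⁺-on f u (λ a∈ b∈ → inj (there a∈) (there b∈))

length-filter-∁ : ∀ {A : Set} {P : A → Set} (P? : Decidable P) xs →
  length (filter P? xs) + length (filter (∁? P?) xs) ≡ length xs
length-filter-∁ P? [] = refl
length-filter-∁ P? (x ∷ xs) with P? x
... | yes _ = cong suc (length-filter-∁ P? xs)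
... | no _ = trans (+-suc _ _) (cong suc (length-filter-∁ P? xs))

maxOf : (Cell → ℕ) → List Cell → ℕ
maxOf f S = foldr _⊔_ 0 (map f S)

maxX maxY : List Cell → ℕ
maxX = maxOf proj₁
maxY = maxOf proj₂

≤maxOf : ∀ f {S c} → c ∈ S → f c ≤ maxOf f S
≤maxOf f {a ∷ S} (here refl) = m≤m⊔n (f a) _
≤maxOf f {a ∷ S} (there c∈S) = ≤-trans (≤maxOf f c∈S) (m≤n⊔m (f a) _)

maxOf≤ : ∀ f {S k} → (∀ {c} → c ∈ S → f c ≤ k) → maxOf f S ≤ k
maxOf≤ f {[]} bound = z≤n
maxOf≤ f {a ∷ S} bound = ⊔-lub (bound (here refl)) (maxOf≤ f (λ c∈S → bound (there c∈S)))

maxOf-≡ : ∀ f {S k c} → (∀ {d} → d ∈ S → f d ≤ k) → c ∈ S → f c ≡ k → maxOf f S ≡ k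
maxOf-≡ f bound c∈S refl = ≤-antisym (maxOf≤ f bound) (≤maxOf f c∈S)

maxOf-attained : ∀ f {S c} → c ∈ S → ∃ λ d → d ∈ S × f d ≡ maxOf f S
maxOf-attained f {a ∷ []} _ = a , here refl , sym (⊔-identityʳ (f a))
maxOf-attained f {a ∷ b ∷ S} _ = pick (⊔-sel (f a) (maxOf f (b ∷ S))) (maxOf-attained f {b ∷ S} (here refl))
  where
  pick : f a ⊔ maxOf f (b ∷ S) ≡ f a ⊎ f a ⊔ maxOf f (b ∷ S) ≡ maxOf f (b ∷ S) →
         ∃ (λ d → d ∈ b ∷ S × f d ≡ maxOf f (b ∷ S)) → ∃ λ d → d ∈ a ∷ b ∷ S × f d ≡ maxOf f (a ∷ b ∷ S)
  pick (inj₁ e) _ = a , here refl , sym e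
  pick (inj₂ e) (d , d∈ , fd≡) = d , there d∈ , trans fd≡ (sym e)

x<width : ∀ {S c} → c ∈ S → proj₁ c < width S
x<width c∈S = s≤s (≤maxOf proj₁ c∈S)

y<height : ∀ {S c} → c ∈ S → proj₂ c < height S
y<height c∈S = s≤s (≤maxOf proj₂ c∈S)

InBox : ℕ → ℕ → Cell → Set
InBox W H c = proj₁ c < W × proj₂ c < H

column : ℕ → ℕ → List Cell
column x = applyUpTo (x ,_)

box : ℕ → ℕ → List Cell
box W H = cartesianProduct (upTo W) (upTo H)

∈box⁺ : ∀ {W H c} → InBox W H c → c ∈ box W H
∈box⁺ (x<W , y<H) = ∈-cartesianProduct⁺ (∈-upTo⁺ x<W) (∈-upTo⁺ y<H)

∈box⁻ : ∀ {W H} c → c ∈ box W H → InBox W H c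
∈box⁻ {W} {H} _ c∈box with x∈ , y∈ ← ∈-cartesianProduct⁻ (upTo W) (upTo H) c∈box = ∈-upTo⁻ x∈ , ∈-upTo⁻ y∈

private
  upTo-increasing : ∀ n → AllPairs _<_ (upTo n)
  upTo-increasing n = AllPairs.applyUpTo⁺₁ (λ i → i) n (λ i<j _ → i<j)

  cartesianProduct-sorted : ∀ {xs ys} → AllPairs _<_ xs → AllPairs _<_ ys → AllPairs _<ᶜ_ (cartesianProduct xs ys)
  cartesianProduct-sorted {[]} [] _ = []
  cartesianProduct-sorted {x ∷ xs} {ys} (x<xs ∷ xs↑) ys↑ =
    AllPairs.++⁺ (AllPairs.map⁺ (AllPairs.map (λ y<y′ → inj₂ (refl , y<y′)) ys↑)) (cartesianProduct-sorted xs↑ ys↑)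
      (All.tabulate λ c∈row → All.tabulate λ d∈rest → inj₁ (x<rest c∈row d∈rest))
    where
    x<rest : ∀ {c d} → c ∈ map (x ,_) ys → d ∈ cartesianProduct xs ys → proj₁ c < proj₁ d
    x<rest c∈row d∈rest with _ , _ , refl ← ∈-map⁻ (x ,_) c∈row =
      All.lookup x<xs (proj₁ (∈-cartesianProduct⁻ xs ys d∈rest))

box-sorted : ∀ W H → Sorted (box W H)
box-sorted W H = Linked.AllPairs⇒Linked (cartesianProduct-sorted (upTo-increasing W) (upTo-increasing H))

length-column : ∀ x n → length (column x n) ≡ n
length-column x = length-applyUpTo (x ,_)

column-sorted : ∀ x n → Sorted (column x n)
column-sorted x n = Linked.AllPairs⇒Linked (AllPairs.applyUpTo⁺₁ (x ,_) n (λ i<j _ → inj₂ (refl , i<j)))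

∈column⁻ : ∀ {x n c} → c ∈ column x n → ∃ λ y → c ≡ (x , y) × y < n
∈column⁻ c∈ with y , y<n , refl ← ∈-applyUpTo⁻ _ c∈ = y , refl , y<n

sortCells : ℕ → ℕ → List Cell → List Cell
sortCells W H L = filter (_∈? L) (box W H)

sortCells-sorted : ∀ W H L → Sorted (sortCells W H L)
sortCells-sorted W H L = Linked.filter⁺ (_∈? L) <ᶜ-trans (box-sorted W H)

∈sortCells⁺ : ∀ {W H L c} → c ∈ L → InBox W H c → c ∈ sortCells W H L
∈sortCells⁺ {L = L} c∈L inBox = ∈-filter⁺ (_∈? L) (∈box⁺ inBox) c∈L

∈sortCells⁻ : ∀ {W H L c} → c ∈ sortCells W H L → c ∈ L × InBox W H c
∈sortCells⁻ {W} {H} {L} {c} c∈ with c∈box , c∈L ← ∈-filter⁻ (_∈? L) {xs = box W H} c∈ = c∈L , ∈box⁻ c c∈box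

sortCells-set : ∀ {W H L} → (∀ {c} → c ∈ L → InBox W H c) → sortCells W H L ∼[ set ] L
sortCells-set {W} {H} inBox = mk⇔ (λ c∈ → proj₁ (∈sortCells⁻ {W} {H} c∈)) (λ c∈L → ∈sortCells⁺ c∈L (inBox c∈L))

length-sortCells : ∀ {W H L} → Unique L → (∀ {c} → c ∈ L → InBox W H c) → length (sortCells W H L) ≡ length L
length-sortCells {W} {H} {L} uL inBox =
  unique-set⇒length-≡ (Sorted⇒Unique (sortCells-sorted W H L)) uL (sortCells-set inBox)

sortCells-id : ∀ {W H S} → Sorted S → (∀ {c} → c ∈ S → InBox W H c) → sortCells W H S ≡ S
sortCells-id {W} {H} {S} sS inBox = sorted-set⇒≡ (sortCells-sorted W H S) sS (sortCells-set inBox)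

sublists : ∀ {A : Set} → List A → List (List A)
sublists [] = [ [] ]
sublists (x ∷ xs) = map (x ∷_) (sublists xs) ++ sublists xs

filter∈sublists : ∀ {A : Set} {P : A → Set} (P? : Decidable P) xs → filter P? xs ∈ sublists xs
filter∈sublists P? [] = here refl
filter∈sublists P? (x ∷ xs) with does (P? x)
... | true = ∈-++⁺ˡ (∈-map⁺ (x ∷_) (filter∈sublists P? xs))
... | false = ∈-++⁺ʳ (map (x ∷_) (sublists xs)) (filter∈sublists P? xs)

sublist-⊆ : ∀ {A : Set} xs {ys} {a : A} → ys ∈ sublists xs → a ∈ ys → a ∈ xs
sublist-⊆ [] (here refl) ()
sublist-⊆ (x ∷ xs) ys∈ a∈ys with ∈-++⁻ (map (x ∷_) (sublists xs)) ys∈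
... | inj₂ ys∈′ = there (sublist-⊆ xs ys∈′ a∈ys)
... | inj₁ x∷zs∈ with zs , zs∈ , refl ← ∈-map⁻ (x ∷_) x∷zs∈ with a∈ys
...   | here a≡x = here a≡x
...   | there a∈zs = there (sublist-⊆ xs zs∈ a∈zs)

sublists-unique : ∀ {A : Set} {xs : List A} → Unique xs → Unique (sublists xs)
sublists-unique {xs = []} [] = [] ∷ []
sublists-unique {xs = x ∷ xs} (x∉xs ∷ u) =
  Unique.++⁺ (Unique.map⁺ (λ { refl → refl }) (sublists-unique u)) (sublists-unique u) disjoint
  where
  disjoint : ∀ {ys} → ¬ (ys ∈ map (x ∷_) (sublists xs) × ys ∈ sublists xs)
  disjoint (x∷zs∈ , ys∈) with _ , _ , refl ← ∈-map⁻ (x ∷_) x∷zs∈ =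
    All.lookup x∉xs (sublist-⊆ xs ys∈ (here refl)) refl

sorted∈sublists-box : ∀ {W H S} → Sorted S → (∀ {c} → c ∈ S → InBox W H c) → S ∈ sublists (box W H)
sorted∈sublists-box {W} {H} {S} sS inBox =
  subst (_∈ sublists (box W H)) (sortCells-id sS inBox) (filter∈sublists (_∈? S) (box W H))

count-filter : ∀ {P : List Cell → Set} {U} → Unique U → (P? : Decidable P) → (∀ {S} → P S → S ∈ U) →
  Count P (length (filter P? U))
count-filter {U = U} uU P? P⇒∈U = filter P? U , refl , Unique.filter⁺ P? uU ,
  λ S → mk⇔ (λ S∈ → proj₂ (∈-filter⁻ P? {xs = U} S∈)) (λ PS → ∈-filter⁺ P? (P⇒∈U PS) PS)

count-resp-⇔ : ∀ {P Q : List Cell → Set} {n} → (∀ S → P S ⇔ Q S) → Count P n → Count Q n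
count-resp-⇔ P⇔Q (L , len , uL , ∈L⇔P) =
  L , len , uL , λ S → mk⇔ (to (P⇔Q S) ∘ to (∈L⇔P S)) (from (∈L⇔P S) ∘ from (P⇔Q S))

count-split : ∀ {P Q : List Cell → Set} {n} → Decidable Q → Count P n →
  ∃₂ λ k l → Count (P ∩ Q) k × Count (P ∩ ∁ Q) l × k + l ≡ n
count-split {P} {Q} Q? (L , refl , uL , ∈L⇔P) =
  length (filter Q? L) , length (filter (∁? Q?) L) , part Q? , part (∁? Q?) , length-filter-∁ Q? L
  where
  part : ∀ {R : List Cell → Set} (R? : Decidable R) → Count (P ∩ R) (length (filter R? L))
  part R? = filter R? L , refl , Unique.filter⁺ R? uL , λ S → mk⇔
    (λ S∈ → let S∈L , RS = ∈-filter⁻ R? {xs = L} S∈ in to (∈L⇔P S) S∈L , RS)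
    (λ (PS , RS) → ∈-filter⁺ R? (from (∈L⇔P S) PS) RS)

count-images : ∀ {P Q R : List Cell → Set} {m n} (f g : List Cell → List Cell) → Count P m → Count Q n →
  (∀ {S T} → P S → P T → f S ≡ f T → S ≡ T) →
  (∀ {S T} → Q S → Q T → g S ≡ g T → S ≡ T) →
  (∀ {S T} → P S → Q T → f S ≢ g T) →
  (∀ X → R X ⇔ ((∃ λ S → P S × f S ≡ X) ⊎ (∃ λ S → Q S × g S ≡ X))) →
  Count R (m + n)
count-images {P} {Q} {R} f g (LP , refl , uP , ∈LP⇔P) (LQ , refl , uQ , ∈LQ⇔Q) f-inj g-inj f≢g R⇔ =
  map f LP ++ map g LQ ,
  trans (length-++ (map f LP)) (cong₂ _+_ (length-map f LP) (length-map g LQ)) ,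
  Unique.++⁺ (unique-map⁺-on f uP λ S∈ T∈ → f-inj (P∈ S∈) (P∈ T∈))
             (unique-map⁺-on g uQ λ S∈ T∈ → g-inj (Q∈ S∈) (Q∈ T∈)) disjoint ,
  λ X → mk⇔ (from (R⇔ X) ∘ fromImages) (toImages ∘ to (R⇔ X))
  where
  P∈ : ∀ {S} → S ∈ LP → P S
  P∈ {S} = to (∈LP⇔P S)
  Q∈ : ∀ {S} → S ∈ LQ → Q S
  Q∈ {S} = to (∈LQ⇔Q S)
  disjoint : ∀ {X} → ¬ (X ∈ map f LP × X ∈ map g LQ)
  disjoint (X∈f , X∈g) with S , S∈ , refl ← ∈-map⁻ f X∈f | T , T∈ , fS≡gT ← ∈-map⁻ g X∈g =
    f≢g (P∈ S∈) (Q∈ T∈) fS≡gT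
  fromImages : ∀ {X} → X ∈ map f LP ++ map g LQ → (∃ λ S → P S × f S ≡ X) ⊎ (∃ λ S → Q S × g S ≡ X)
  fromImages X∈ with ∈-++⁻ (map f LP) X∈
  ... | inj₁ X∈f with S , S∈ , refl ← ∈-map⁻ f X∈f = inj₁ (S , P∈ S∈ , refl)
  ... | inj₂ X∈g with S , S∈ , refl ← ∈-map⁻ g X∈g = inj₂ (S , Q∈ S∈ , refl)
  toImages : ∀ {X} → (∃ λ S → P S × f S ≡ X) ⊎ (∃ λ S → Q S × g S ≡ X) → X ∈ map f LP ++ map g LQ
  toImages (inj₁ (S , PS , refl)) = ∈-++⁺ˡ (∈-map⁺ f (from (∈LP⇔P S) PS))
  toImages (inj₂ (S , QS , refl)) = ∈-++⁺ʳ (map f LP) (∈-map⁺ g (from (∈LQ⇔Q S) QS))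

-- Paths, columns and rows of polyominoes

Path-head : ∀ {S a b} → Path S a b → a ∈ S
Path-head (nil a∈S) = a∈S
Path-head (cons a∈S _ _) = a∈S

infixr 5 _++ₚ_

_++ₚ_ : ∀ {S a b c} → Path S a b → Path S b c → Path S a c
nil _ ++ₚ q = q
cons a∈S adj p ++ₚ q = cons a∈S adj (p ++ₚ q)

Adj-sym : ∀ {a b} → Adj a b → Adj b a
Adj-sym east = west
Adj-sym west = east
Adj-sym north = south
Adj-sym south = north

Path-reverse : ∀ {S a b} → Path S a b → Path S b a
Path-reverse (nil a∈S) = nil a∈S
Path-reverse (cons a∈S adj p) = Path-reverse p ++ₚ cons (Path-head p) (Adj-sym adj) (nil a∈S)

NEPath⇒Path : ∀ {S a b} → NEPath S a b → Path S a b
NEPath⇒Path (nil a∈S) = nil a∈S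
NEPath⇒Path (stepE a∈S p) = cons a∈S east (NEPath⇒Path p)
NEPath⇒Path (stepN a∈S p) = cons a∈S north (NEPath⇒Path p)

Path-map : ∀ {S T a b} (f : Cell → Cell) → (∀ {u} → u ∈ S → f u ∈ T) →
  (∀ {u v} → u ∈ S → v ∈ S → Adj u v → Adj (f u) (f v)) → Path S a b → Path T (f a) (f b)
Path-map f f∈ f-adj (nil a∈S) = nil (f∈ a∈S)
Path-map f f∈ f-adj (cons a∈S adj p) = cons (f∈ a∈S) (f-adj a∈S (Path-head p) adj) (Path-map f f∈ f-adj p)

connected-via : ∀ {S} o → (∀ {c} → c ∈ S → Path S o c) → ∀ {c d} → c ∈ S → d ∈ S → Path S c d
connected-via o path c∈S d∈S = Path-reverse (path c∈S) ++ₚ path d∈S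

verticalPath : ∀ {S} x y k → (∀ {j} → j ≤ k → (x , j + y) ∈ S) → Path S (x , y) (x , k + y)
verticalPath x y zero inS = nil (inS z≤n)
verticalPath x y (suc k) inS =
  verticalPath x y k (λ j≤k → inS (m≤n⇒m≤1+n j≤k)) ++ₚ cons (inS (n≤1+n k)) north (nil (inS ≤-refl))

Adj-translate : ∀ {a b} k l → Adj a b → Adj (proj₁ a + k , proj₂ a + l) (proj₁ b + k , proj₂ b + l)
Adj-translate k l east = east
Adj-translate k l west = west
Adj-translate k l north = north
Adj-translate k l south = south

private
  ∸-suc : ∀ P x → suc x ≤ P → P ∸ x ≡ suc (P ∸ suc x)
  ∸-suc (suc P) zero _ = refl
  ∸-suc (suc P) (suc x) (s≤s x<P) = ∸-suc P x x<P

Adj-reflectX : ∀ {a b} P → Adj a b → proj₁ a ≤ P → proj₁ b ≤ P →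
  Adj (P ∸ proj₁ a , proj₂ a) (P ∸ proj₁ b , proj₂ b)
Adj-reflectX P (east {x} {y}) _ x<P = subst (λ z → Adj (z , y) (P ∸ suc x , y)) (sym (∸-suc P x x<P)) west
Adj-reflectX P (west {x} {y}) x<P _ = subst (λ z → Adj (P ∸ suc x , y) (z , y)) (sym (∸-suc P x x<P)) east
Adj-reflectX P north _ _ = north
Adj-reflectX P south _ _ = south

Adj-reflectY : ∀ {a b} Q → Adj a b → proj₂ a ≤ Q → proj₂ b ≤ Q →
  Adj (proj₁ a , Q ∸ proj₂ a) (proj₁ b , Q ∸ proj₂ b)
Adj-reflectY Q east _ _ = east
Adj-reflectY Q west _ _ = west
Adj-reflectY Q (north {x} {y}) _ y<Q = subst (λ z → Adj (x , z) (x , Q ∸ suc y)) (sym (∸-suc Q y y<Q)) south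
Adj-reflectY Q (south {x} {y}) y<Q _ = subst (λ z → Adj (x , Q ∸ suc y) (x , z)) (sym (∸-suc Q y y<Q)) north

Path-crosses : ∀ {S a b} x → Path S a b → proj₁ a ≤ x → x < proj₁ b → ∃ λ y → (x , y) ∈ S × (suc x , y) ∈ S
Path-crosses x (nil _) a≤x x<b = ⊥-elim (<-irrefl refl (≤-<-trans a≤x x<b))
Path-crosses {S} x (cons {d = d} c∈S adj p) c≤x x<b with proj₁ d ≤? x
... | yes d≤x = Path-crosses x p d≤x x<b
... | no d≰x = step adj c∈S (Path-head p) c≤x d≰x
  where
  step : ∀ {c d} → Adj c d → c ∈ S → d ∈ S → proj₁ c ≤ x → ¬ proj₁ d ≤ x →
         ∃ λ y → (x , y) ∈ S × (suc x , y) ∈ S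
  step (east {y = y}) c∈S d∈S c≤x d≰x with refl ← ≤-antisym c≤x (≤-pred (≰⇒> d≰x)) = y , c∈S , d∈S
  step west _ _ c≤x d≰x = ⊥-elim (d≰x (≤-trans (n≤1+n _) c≤x))
  step north _ _ c≤x d≰x = ⊥-elim (d≰x c≤x)
  step south _ _ c≤x d≰x = ⊥-elim (d≰x c≤x)

adjacentColumns-overlap : ∀ {S} → IsPolyomino S → ∀ x → x < maxX S → ∃ λ y → (x , y) ∈ S × (suc x , y) ∈ S
adjacentColumns-overlap {S} P x x<max with _ , left∈S ← IsPolyomino.leftAligned P
  with (_ , _) , right∈S , refl ← maxOf-attained proj₁ left∈S =
  Path-crosses x (IsPolyomino.connected P left∈S right∈S) z≤n x<max

column-nonempty : ∀ {S} → IsPolyomino S → ∀ x → x ≤ maxX S → ∃ λ y → (x , y) ∈ S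
column-nonempty P zero _ = IsPolyomino.leftAligned P
column-nonempty P (suc x) x<max with y , _ , x+1∈S ← adjacentColumns-overlap P x x<max = y , x+1∈S

intervalChain-meets : ∀ {_⊑_ : ℕ → ℕ → Set} → (∀ a b → a ⊑ b ⊎ b ⊑ a) → ∀ (C : ℕ → ℕ → Set) n Y →
  (∀ k {a b c} → C k a → C k c → a ⊑ b → b ⊑ c → C k b) →
  (∀ k → k < n → ∃ λ y → C k y × C (suc k) y) →
  ∀ {y₀ yₙ} → C 0 y₀ → Y ⊑ y₀ → C n yₙ → yₙ ⊑ Y → ∃ λ k → k ≤ n × C k Y
intervalChain-meets total C zero Y interval _ c₀ Y⊑y₀ cₙ yₙ⊑Y = 0 , z≤n , interval 0 cₙ c₀ yₙ⊑Y Y⊑y₀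
intervalChain-meets total C (suc n) Y interval overlaps c₀ Y⊑y₀ cₙ yₙ⊑Y with overlaps 0 (s≤s z≤n)
... | r , r∈C₀ , r∈C₁ with total Y r
...   | inj₂ r⊑Y = 0 , z≤n , interval 0 r∈C₀ c₀ r⊑Y Y⊑y₀
...   | inj₁ Y⊑r with k , k≤n , Y∈Cₖ ← intervalChain-meets total (λ k → C (suc k)) n Y (λ k → interval (suc k))
                                          (λ k k<n → overlaps (suc k) (s≤s k<n)) r∈C₁ Y⊑r cₙ yₙ⊑Y =
  suc k , s≤s k≤n , Y∈Cₖ

Between : ℕ → ℕ → ℕ → Set
Between a Y b = (a ≤ Y × Y ≤ b) ⊎ (b ≤ Y × Y ≤ a)

-- Columns are intervals, adjacent columns overlap: apply intervalChain-meets to the columns x₀ … x₁.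
row-meets : ∀ {X} → IsPolyomino X → Convex X → ∀ {x₀ x₁ y₀ y₁ Y} →
  x₀ ≤ x₁ → (x₀ , y₀) ∈ X → (x₁ , y₁) ∈ X → Between y₀ Y y₁ → ∃ λ x → x₀ ≤ x × x ≤ x₁ × (x , Y) ∈ X
row-meets {X} P (_ , columnConvex) {x₀} {x₁} {y₀} {y₁} {Y} x₀≤x₁ c₀ c₁ between =
  let k , k≤n , Y∈X = meets between
  in x₀ + k , m≤m+n x₀ k , subst (x₀ + k ≤_) x₀+n≡x₁ (+-monoʳ-≤ x₀ k≤n) , Y∈X
  where
  n = x₁ ∸ x₀
  C : ℕ → ℕ → Set
  C k y = (x₀ + k , y) ∈ X
  x₀+n≡x₁ : x₀ + n ≡ x₁
  x₀+n≡x₁ = m+[n∸m]≡n x₀≤x₁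
  overlaps : ∀ k → k < n → ∃ λ y → C k y × C (suc k) y
  overlaps k k<n with y , l , r ← adjacentColumns-overlap P (x₀ + k)
                      (<-≤-trans (+-monoʳ-< x₀ k<n) (subst (_≤ maxX X) (sym x₀+n≡x₁) (≤maxOf proj₁ c₁))) =
    y , l , subst (λ s → (s , y) ∈ X) (sym (+-suc x₀ k)) r
  C₀ : C 0 y₀
  C₀ = subst (λ s → (s , y₀) ∈ X) (sym (+-identityʳ x₀)) c₀
  Cₙ : C n y₁
  Cₙ = subst (λ s → (s , y₁) ∈ X) (sym x₀+n≡x₁) c₁
  meets : Between y₀ Y y₁ → ∃ λ k → k ≤ n × C k Y
  meets (inj₁ (y₀≤Y , Y≤y₁)) = intervalChain-meets (λ a b → ≤-total b a) C n Y
    (λ k a∈ c∈ b≤a c≤b → columnConvex (x₀ + k) _ _ _ c∈ a∈ c≤b b≤a) overlaps C₀ y₀≤Y Cₙ Y≤y₁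
  meets (inj₂ (y₁≤Y , Y≤y₀)) = intervalChain-meets ≤-total C n Y
    (λ k a∈ c∈ a≤b b≤c → columnConvex (x₀ + k) _ _ _ a∈ c∈ a≤b b≤c) overlaps C₀ Y≤y₀ Cₙ y₁≤Y

-- Directed convex polyominoes and stacks

NEPath-snocE : ∀ {S a x y} → NEPath S a (x , y) → (suc x , y) ∈ S → NEPath S a (suc x , y)
NEPath-snocE (nil a∈S) b∈S = stepE a∈S (nil b∈S)
NEPath-snocE (stepE a∈S p) b∈S = stepE a∈S (NEPath-snocE p b∈S)
NEPath-snocE (stepN a∈S p) b∈S = stepN a∈S (NEPath-snocE p b∈S)

NEPath-snocN : ∀ {S a x y} → NEPath S a (x , y) → (x , suc y) ∈ S → NEPath S a (x , suc y)
NEPath-snocN (nil a∈S) b∈S = stepN a∈S (nil b∈S)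
NEPath-snocN (stepE a∈S p) b∈S = stepE a∈S (NEPath-snocN p b∈S)
NEPath-snocN (stepN a∈S p) b∈S = stepN a∈S (NEPath-snocN p b∈S)

NEPath-monotone : ∀ {S a b} → NEPath S a b → proj₁ a ≤ proj₁ b × proj₂ a ≤ proj₂ b
NEPath-monotone (nil _) = ≤-refl , ≤-refl
NEPath-monotone (stepE _ p) = <⇒≤ (proj₁ (NEPath-monotone p)) , proj₂ (NEPath-monotone p)
NEPath-monotone (stepN _ p) = proj₁ (NEPath-monotone p) , <⇒≤ (proj₂ (NEPath-monotone p))

HasPredecessor : List Cell → Cell → Set
HasPredecessor S (zero , zero) = ⊤
HasPredecessor S (suc x , zero) = (x , zero) ∈ S
HasPredecessor S (zero , suc y) = (zero , y) ∈ S
HasPredecessor S (suc x , suc y) = (x , suc y) ∈ S ⊎ (suc x , y) ∈ S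

hasPredecessor? : ∀ S c → Dec (HasPredecessor S c)
hasPredecessor? S (zero , zero) = yes tt
hasPredecessor? S (suc x , zero) = (x , zero) ∈? S
hasPredecessor? S (zero , suc y) = (zero , y) ∈? S
hasPredecessor? S (suc x , suc y) with (x , suc y) ∈? S | (suc x , y) ∈? S
... | yes west∈S | _ = yes (inj₁ west∈S)
... | no _ | yes south∈S = yes (inj₂ south∈S)
... | no west∉S | no south∉S = no λ { (inj₁ west∈S) → west∉S west∈S ; (inj₂ south∈S) → south∉S south∈S }

private
  -- n ≥ x + y bounds the length of the path, which is built backwards from (x , y).
  NEPath-fromOrigin : ∀ {S} → (∀ {c} → c ∈ S → HasPredecessor S c) →
    ∀ n {x y} → x + y ≤ n → (x , y) ∈ S → NEPath S (0 , 0) (x , y)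
  NEPath-fromOrigin pred n {zero} {zero} _ c∈S = nil c∈S
  NEPath-fromOrigin pred (suc n) {suc x} {zero} (s≤s le) c∈S =
    NEPath-snocE (NEPath-fromOrigin pred n le (pred c∈S)) c∈S
  NEPath-fromOrigin pred (suc n) {zero} {suc y} (s≤s le) c∈S =
    NEPath-snocN (NEPath-fromOrigin pred n le (pred c∈S)) c∈S
  NEPath-fromOrigin pred (suc n) {suc x} {suc y} (s≤s le) c∈S with pred c∈S
  ... | inj₁ west∈S = NEPath-snocE (NEPath-fromOrigin pred n le west∈S) c∈S
  ... | inj₂ south∈S = NEPath-snocN (NEPath-fromOrigin pred n (≤-trans (≤-reflexive (sym (+-suc x y))) le) south∈S) c∈S

hasPredecessors⇒NEPath : ∀ {S} → (∀ {c} → c ∈ S → HasPredecessor S c) → ∀ {c} → c ∈ S → NEPath S (0 , 0) c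
hasPredecessors⇒NEPath pred {x , y} = NEPath-fromOrigin pred (x + y) ≤-refl

hasPredecessors⇒Directed : ∀ {S} → (0 , 0) ∈ S → (∀ {c} → c ∈ S → HasPredecessor S c) → Directed S
hasPredecessors⇒Directed o pred = (0 , 0) , o , λ _ → hasPredecessors⇒NEPath pred

private
  east-predecessor : ∀ {S x y} → (x , y) ∈ S → HasPredecessor S (suc x , y)
  east-predecessor {y = zero} west∈S = west∈S
  east-predecessor {y = suc y} west∈S = inj₁ west∈S

  north-predecessor : ∀ {S x y} → (x , y) ∈ S → HasPredecessor S (x , suc y)
  north-predecessor {x = zero} south∈S = south∈S
  north-predecessor {x = suc x} south∈S = inj₂ south∈S

NEPath⇒HasPredecessor : ∀ {S a b} → NEPath S a b → a ≡ b ⊎ HasPredecessor S b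
NEPath⇒HasPredecessor (nil _) = inj₁ refl
NEPath⇒HasPredecessor (stepE a∈S p) with NEPath⇒HasPredecessor p
... | inj₁ refl = inj₂ (east-predecessor a∈S)
... | inj₂ pred = inj₂ pred
NEPath⇒HasPredecessor (stepN a∈S p) with NEPath⇒HasPredecessor p
... | inj₁ refl = inj₂ (north-predecessor a∈S)
... | inj₂ pred = inj₂ pred

Directed-source-origin : ∀ {S} → IsPolyomino S → Directed S → (0 , 0) ∈ S × (∀ {c} → c ∈ S → NEPath S (0 , 0) c)
Directed-source-origin P (s , s∈S , path)
  with _ , left∈S ← IsPolyomino.leftAligned P | _ , bottom∈S ← IsPolyomino.bottomAligned P
  with refl ← n≤0⇒n≡0 (proj₁ (NEPath-monotone (path _ left∈S)))
     | refl ← n≤0⇒n≡0 (proj₂ (NEPath-monotone (path _ bottom∈S))) =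
  s∈S , path _

Directed⇒hasPredecessors : ∀ {S} → (∀ {c} → c ∈ S → NEPath S (0 , 0) c) → ∀ {c} → c ∈ S → HasPredecessor S c
Directed⇒hasPredecessors path c∈S with NEPath⇒HasPredecessor (path c∈S)
... | inj₁ refl = tt
... | inj₂ pred = pred

all∈? : ∀ {P : Cell → Set} → Decidable P → ∀ S → Dec (∀ {c} → c ∈ S → P c)
all∈? P? S = map′ All.lookup All.tabulate (all? P? S)

LocallyConvex : List Cell → Set
LocallyConvex S = ∀ {u} → u ∈ S → ∀ {v} → v ∈ S →
  (proj₂ u ≡ proj₂ v → proj₁ u < proj₁ v → (suc (proj₁ u) , proj₂ u) ∈ S) ×
  (proj₁ u ≡ proj₁ v → proj₂ u < proj₂ v → (proj₁ u , suc (proj₂ u)) ∈ S)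

locallyConvex? : ∀ S → Dec (LocallyConvex S)
locallyConvex? S = all∈? (λ u → all∈? (λ v →
  ((proj₂ u ≟ proj₂ v) →-dec ((proj₁ u <? proj₁ v) →-dec ((suc (proj₁ u) , proj₂ u) ∈? S))) ×-dec
  ((proj₁ u ≟ proj₁ v) →-dec ((proj₂ u <? proj₂ v) →-dec ((proj₁ u , suc (proj₂ u)) ∈? S)))) S) S

private
  row-fill : ∀ {S} → LocallyConvex S → ∀ {a c y} k → (a , y) ∈ S → (c , y) ∈ S → k + a ≤ c → (k + a , y) ∈ S
  row-fill lc zero a∈S _ _ = a∈S
  row-fill lc (suc k) a∈S c∈S k+a<c = proj₁ (lc (row-fill lc k a∈S c∈S (<⇒≤ k+a<c)) c∈S) refl k+a<c

  column-fill : ∀ {S} → LocallyConvex S → ∀ {x a c} k → (x , a) ∈ S → (x , c) ∈ S → k + a ≤ c → (x , k + a) ∈ S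
  column-fill lc zero a∈S _ _ = a∈S
  column-fill lc (suc k) a∈S c∈S k+a<c = proj₂ (lc (column-fill lc k a∈S c∈S (<⇒≤ k+a<c)) c∈S) refl k+a<c

LocallyConvex⇒Convex : ∀ {S} → LocallyConvex S → Convex S
LocallyConvex⇒Convex {S} lc =
  (λ y a b c a∈S c∈S a≤b b≤c → subst (λ z → (z , y) ∈ S) (m∸n+n≡m a≤b)
     (row-fill lc (b ∸ a) a∈S c∈S (subst (_≤ c) (sym (m∸n+n≡m a≤b)) b≤c))) ,
  (λ x a b c a∈S c∈S a≤b b≤c → subst (λ z → (x , z) ∈ S) (m∸n+n≡m a≤b)
     (column-fill lc (b ∸ a) a∈S c∈S (subst (_≤ c) (sym (m∸n+n≡m a≤b)) b≤c)))

Convex⇒LocallyConvex : ∀ {S} → Convex S → LocallyConvex S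
Convex⇒LocallyConvex (rowConvex , columnConvex) {a , y} a∈S {c , y′} c∈S =
  (λ { refl a<c → rowConvex y a (suc a) c a∈S c∈S (n≤1+n a) a<c }) ,
  (λ { refl y<y′ → columnConvex a y (suc y) y′ a∈S c∈S (n≤1+n y) y<y′ })

-- Since the source of a normalised directed polyomino is the origin (Directed-source-origin),
-- directed convexity is equivalent to this decidable property.
IsDCP : List Cell → Set
IsDCP S = Sorted S × (0 , 0) ∈ S × LocallyConvex S × (∀ {c} → c ∈ S → HasPredecessor S c)

isDCP? : ∀ S → Dec (IsDCP S)
isDCP? S = Linked.linked? _<ᶜ?_ S ×-dec ((0 , 0) ∈? S ×-dec (locallyConvex? S ×-dec all∈? (hasPredecessor? S) S))

IsDCP⇒IsPolyomino : ∀ {S} → IsDCP S → IsPolyomino S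
IsDCP⇒IsPolyomino (sorted , o , _ , pred) = record
  { sorted = sorted
  ; nonempty = ∈⇒nonempty o
  ; leftAligned = 0 , o
  ; bottomAligned = 0 , o
  ; connected = connected-via (0 , 0) (NEPath⇒Path ∘ hasPredecessors⇒NEPath pred)
  }

IsDCP⇔IsDirectedConvex : ∀ {S} → IsDCP S ⇔ IsDirectedConvex S
IsDCP⇔IsDirectedConvex = mk⇔
  (λ dcp@(_ , o , lc , pred) → (IsDCP⇒IsPolyomino dcp , LocallyConvex⇒Convex lc) , hasPredecessors⇒Directed o pred)
  (λ ((P , cv) , dir) → let o , path = Directed-source-origin P dir in
     IsPolyomino.sorted P , o , Convex⇒LocallyConvex cv , Directed⇒hasPredecessors path)

DClass? : ∀ n H A → Decidable (DClass n H A)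
DClass? n H A S = map′ (λ (dcp , sizes) → to IsDCP⇔IsDirectedConvex dcp , sizes)
                       (λ (dc , sizes) → from IsDCP⇔IsDirectedConvex dc , sizes)
  (isDCP? S ×-dec ((2 * width S ≟ n) ×-dec ((2 * height S ≟ H + leftColHeight S) ×-dec (2 * area S ≟ A + leftColHeight S))))

leftColumn : List Cell → List Cell
leftColumn S = filter (λ c → proj₁ c ≟ 0) S

leftColHeight≤area : ∀ S → leftColHeight S ≤ area S
leftColHeight≤area S = length-filter (λ c → proj₁ c ≟ 0) S

private
  2*n≡n+n : ∀ n → 2 * n ≡ n + n
  2*n≡n+n n = cong (n +_) (+-identityʳ n)

DClass⇒inBox : ∀ {n H A S} → DClass n H A S → ∀ {c} → c ∈ S → InBox n (H + A) c
DClass⇒inBox {n} {H} {A} {S} (_ , 2w≡n , 2h≡ , 2a≡) c∈S =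
  <-≤-trans (x<width c∈S) w≤n , <-≤-trans (y<height c∈S) h≤H+A
  where
  open ≤-Reasoning
  w≤n : width S ≤ n
  w≤n = subst (width S ≤_) (trans (sym (2*n≡n+n (width S))) 2w≡n) (m≤m+n _ _)
  a≤A : area S ≤ A
  a≤A = +-cancelʳ-≤ (area S) (area S) A (begin
    area S + area S               ≡⟨ sym (2*n≡n+n (area S)) ⟩
    2 * area S                    ≡⟨ 2a≡ ⟩
    A + leftColHeight S           ≤⟨ +-monoʳ-≤ A (leftColHeight≤area S) ⟩
    A + area S                    ∎)
  h≤H+A : height S ≤ H + A
  h≤H+A = begin
    height S                      ≤⟨ m≤n+m (height S) (height S) ⟩
    height S + height S           ≡⟨ sym (2*n≡n+n (height S)) ⟩
    2 * height S                  ≡⟨ 2h≡ ⟩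
    H + leftColHeight S           ≤⟨ +-monoʳ-≤ H (≤-trans (leftColHeight≤area S) a≤A) ⟩
    H + A                         ∎

leftColHeight-≡ : ∀ {S n} → Unique S → (∀ y → (0 , y) ∈ S ⇔ y < n) → leftColHeight S ≡ n
leftColHeight-≡ {S} {n} uS column₀ =
  trans (unique-set⇒length-≡ (Unique.filter⁺ _ uS) (Sorted⇒Unique (column-sorted 0 n)) (mk⇔ into back))
        (length-column 0 n)
  where
  into : ∀ {c} → c ∈ leftColumn S → c ∈ column 0 n
  into {_ , y} c∈ with c∈S , refl ← ∈-filter⁻ (λ c → proj₁ c ≟ 0) {xs = S} c∈ =
    ∈-applyUpTo⁺ (0 ,_) (to (column₀ y) c∈S)
  back : ∀ {c} → c ∈ column 0 n → c ∈ leftColumn S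
  back c∈ with y , refl , y<n ← ∈column⁻ c∈ = ∈-filter⁺ (λ c → proj₁ c ≟ 0) (from (column₀ y) y<n) refl

leftColumn-interval : ∀ {S} → IsDCP S → ∀ y → (0 , y) ∈ S ⇔ y < leftColHeight S
leftColumn-interval {S} (sorted , o , lc , _) y =
  subst (λ n → (0 , y) ∈ S ⇔ y < n) (sym (leftColHeight-≡ (Sorted⇒Unique sorted) below-top)) (below-top y)
  where
  top = maxY (leftColumn S)
  top∈S : (0 , top) ∈ S
  top∈S with (_ , _) , t∈ , refl ← maxOf-attained proj₂ (∈-filter⁺ (λ c → proj₁ c ≟ 0) o refl)
    with t∈S , refl ← ∈-filter⁻ (λ c → proj₁ c ≟ 0) {xs = S} t∈ = t∈S
  below-top : ∀ y → (0 , y) ∈ S ⇔ y < suc top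
  below-top y = mk⇔ (λ y∈S → s≤s (≤maxOf proj₂ (∈-filter⁺ (λ c → proj₁ c ≟ 0) y∈S refl)))
                    (λ y≤top → proj₂ (LocallyConvex⇒Convex lc) 0 0 y top o top∈S z≤n (≤-pred y≤top))

leftColHeight-pos : ∀ {S} → IsDCP S → 0 < leftColHeight S
leftColHeight-pos dcp@(_ , o , _) = to (leftColumn-interval dcp 0) o

leftColHeight≤height : ∀ {S} → IsDCP S → leftColHeight S ≤ height S
leftColHeight≤height {S} dcp with leftColHeight S in eq
... | zero = z≤n
... | suc c = y<height (from (leftColumn-interval dcp c) (subst (c <_) (sym eq) ≤-refl))

LeftColumnFull : List Cell → Set
LeftColumnFull S = leftColHeight S ≡ height S

IsStack⇒IsDCP : ∀ {S} → IsStack S → IsDCP S × LeftColumnFull S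
IsStack⇒IsDCP {S} (P , h , r , k , mem , pos , inc , dec) =
  (IsPolyomino.sorted P , o , Convex⇒LocallyConvex (rowConvex , columnConvex) , pred) , trans lch≡h (sym height≡h)
  where
  0<h : 0 < h
  0<h = proj₁ (to (mem _ 0) (proj₂ (IsPolyomino.bottomAligned P)))
  o : (0 , 0) ∈ S
  o = from (mem 0 0) (0<h , pos 0 0<h)
  rowConvex : ∀ y a b c → (a , y) ∈ S → (c , y) ∈ S → a ≤ b → b ≤ c → (b , y) ∈ S
  rowConvex y a b c _ c∈S _ b≤c = from (mem b y) (proj₁ (to (mem c y) c∈S) , ≤-<-trans b≤c (proj₂ (to (mem c y) c∈S)))
  columnConvex : ∀ x a b c → (x , a) ∈ S → (x , c) ∈ S → a ≤ b → b ≤ c → (x , b) ∈ S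
  columnConvex x a b c a∈S c∈S a≤b b≤c with ≤-total b k
  ... | inj₁ b≤k = from (mem x b) (≤-<-trans b≤c (proj₁ (to (mem x c) c∈S)) ,
                                   <-≤-trans (proj₂ (to (mem x a) a∈S)) (inc a b a≤b b≤k))
  ... | inj₂ k≤b = from (mem x b) (≤-<-trans b≤c (proj₁ (to (mem x c) c∈S)) ,
                                   <-≤-trans (proj₂ (to (mem x c) c∈S)) (dec b c k≤b b≤c (proj₁ (to (mem x c) c∈S))))
  pred : ∀ {c} → c ∈ S → HasPredecessor S c
  pred {zero , zero} _ = tt
  pred {suc x , zero} c∈S = from (mem x 0) (proj₁ (to (mem _ _) c∈S) , <-trans (n<1+n x) (proj₂ (to (mem _ _) c∈S)))
  pred {zero , suc y} c∈S = from (mem 0 y) (y<h , pos y y<h)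
    where y<h = <-trans (n<1+n y) (proj₁ (to (mem _ _) c∈S))
  pred {suc x , suc y} c∈S =
    inj₁ (from (mem x (suc y)) (proj₁ (to (mem _ _) c∈S) , <-trans (n<1+n x) (proj₂ (to (mem _ _) c∈S))))
  lch≡h : leftColHeight S ≡ h
  lch≡h = leftColHeight-≡ (Sorted⇒Unique (IsPolyomino.sorted P))
            λ y → mk⇔ (λ y∈S → proj₁ (to (mem 0 y) y∈S)) (λ y<h → from (mem 0 y) (y<h , pos y y<h))
  1+[h-1]≡h : suc (h ∸ 1) ≡ h
  1+[h-1]≡h = trans (+-comm 1 (h ∸ 1)) (m∸n+n≡m 0<h)
  height≡h : height S ≡ h
  height≡h = trans (cong suc (maxOf-≡ proj₂ (λ {(x , y)} c∈S → ∸-monoˡ-≤ 1 (proj₁ (to (mem x y) c∈S)))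
                       (from (mem 0 (h ∸ 1)) (≤-reflexive 1+[h-1]≡h , pos (h ∸ 1) (≤-reflexive 1+[h-1]≡h))) refl))
                   1+[h-1]≡h

-- Row y is [0 , rowLength y); rows grow up to the row k of a rightmost cell and shrink above it,
-- since a dip on either side of k would break the convexity of some column.
module _ {S} (dcp : IsDCP S) (full : LeftColumnFull S) where
  private
    rowConvex = proj₁ (LocallyConvex⇒Convex (proj₁ (proj₂ (proj₂ dcp))))
    columnConvex = proj₂ (LocallyConvex⇒Convex (proj₁ (proj₂ (proj₂ dcp))))
    row : ℕ → List Cell
    row y = filter (λ c → proj₂ c ≟ y) S
    rowLength : ℕ → ℕ
    rowLength y = maxOf (λ c → suc (proj₁ c)) (row y)
    leftFull : ∀ {y} → y < height S → (0 , y) ∈ S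
    leftFull {y} y<h = from (leftColumn-interval dcp y) (subst (y <_) (sym full) y<h)
    mem⁺ : ∀ {x y} → (x , y) ∈ S → y < height S × x < rowLength y
    mem⁺ {x} {y} c∈S = y<height c∈S , ≤maxOf (λ c → suc (proj₁ c)) (∈-filter⁺ (λ c → proj₂ c ≟ y) c∈S refl)
    mem⁻ : ∀ {x y} → y < height S × x < rowLength y → (x , y) ∈ S
    mem⁻ {x} {y} (y<h , x<r)
      with (x′ , _) , c∈ , x′+1≡r ← maxOf-attained (λ c → suc (proj₁ c)) (∈-filter⁺ (λ c → proj₂ c ≟ y) (leftFull y<h) refl)
      with c∈S , refl ← ∈-filter⁻ (λ c → proj₂ c ≟ y) {xs = S} c∈ =
      rowConvex y 0 x x′ (leftFull y<h) c∈S z≤n (≤-pred (subst (x <_) (sym x′+1≡r) x<r))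
    widest = maxOf-attained proj₁ (proj₁ (proj₂ dcp))
    k = proj₂ (proj₁ widest)
    k<h : k < height S
    k<h = y<height (proj₁ (proj₂ widest))
    rowLength≤k : ∀ y → rowLength y ≤ rowLength k
    rowLength≤k y =
      ≤-trans (maxOf≤ (λ c → suc (proj₁ c)) (λ c∈ → s≤s (≤maxOf proj₁ (proj₁ (∈-filter⁻ (λ c → proj₂ c ≟ y) {xs = S} c∈)))))
              (subst (_≤ rowLength k) (cong suc (proj₂ (proj₂ widest))) (proj₂ (mem⁺ (proj₁ (proj₂ widest)))))
    increasing : ∀ i j → i ≤ j → j ≤ k → rowLength i ≤ rowLength j
    increasing i j i≤j j≤k with rowLength i ≤? rowLength j
    ... | yes ≤ = ≤
    ... | no ≰ = ⊥-elim (<-irrefl refl (proj₂ (mem⁺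
                   (columnConvex (rowLength j) i j k (mem⁻ (i<h , rj<ri)) (mem⁻ (k<h , <-≤-trans rj<ri (rowLength≤k i))) i≤j j≤k))))
      where
      rj<ri = ≰⇒> ≰
      i<h = ≤-<-trans (≤-trans i≤j j≤k) k<h
    decreasing : ∀ i j → k ≤ i → i ≤ j → j < height S → rowLength j ≤ rowLength i
    decreasing i j k≤i i≤j j<h with rowLength j ≤? rowLength i
    ... | yes ≤ = ≤
    ... | no ≰ = ⊥-elim (<-irrefl refl (proj₂ (mem⁺
                   (columnConvex (rowLength i) k i j (mem⁻ (k<h , <-≤-trans ri<rj (rowLength≤k j))) (mem⁻ (j<h , ri<rj)) k≤i i≤j))))
      where ri<rj = ≰⇒> ≰

  IsDCP⇒IsStack : IsStack S
  IsDCP⇒IsStack = IsDCP⇒IsPolyomino dcp , height S , rowLength , k ,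
    (λ x y → mk⇔ mem⁺ mem⁻) , (λ y y<h → proj₂ (mem⁺ (leftFull y<h))) , increasing , decreasing

DClass∩LeftColumnFull⇔TClass : ∀ {n H A S} → (DClass n H A ∩ LeftColumnFull) S ⇔ TClass n H A S
DClass∩LeftColumnFull⇔TClass {n} {H} {A} {S} = mk⇔
  (λ ((dc , 2w≡ , 2h≡ , 2a≡) , full) →
     IsDCP⇒IsStack (from IsDCP⇔IsDirectedConvex dc) full , 2w≡ ,
     +-cancelʳ-≡ (height S) (height S) H (trans (sym (2*n≡n+n (height S))) (trans 2h≡ (cong (H +_) full))) ,
     trans 2a≡ (cong (A +_) full))
  (λ (stack , 2w≡ , h≡ , 2a≡) → let dcp , full = IsStack⇒IsDCP stack in
     (to IsDCP⇔IsDirectedConvex dcp , 2w≡ , trans (2*n≡n+n (height S)) (cong₂ _+_ h≡ (sym full)) ,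
      trans 2a≡ (cong (A +_) (sym full))) , full)

-- Gluing a directed convex polyomino to its rotation

RotationClosed : List Cell → Set
RotationClosed X = ∀ {x y} → (x , y) ∈ X → (maxX X ∸ x , maxY X ∸ y) ∈ X

RotInvariant⇔RotationClosed : ∀ {X} → RotInvariant X ⇔ RotationClosed X
RotInvariant⇔RotationClosed {X} = mk⇔
  (λ ri {x} {y} z∈X → from (ri (maxX X ∸ x , maxY X ∸ y)) (∈-map⁺ (rot180 X) z∈X))
  (λ closed (x , y) → mk⇔
    (λ z∈X → subst (_∈ map (rot180 X) X) (cong₂ _,_ (m∸[m∸n]≡n (≤maxOf proj₁ z∈X)) (m∸[m∸n]≡n (≤maxOf proj₂ z∈X)))
                   (∈-map⁺ (rot180 X) (closed z∈X)))
    (λ z∈rot → let _ , z′∈X , z≡ = ∈-map⁻ (rot180 X) z∈rot in subst (_∈ X) (sym z≡) (closed z′∈X)))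

RightCellBelowMiddle RightCellAboveMiddle : ℕ → List Cell → Set
RightCellBelowMiddle m X = ∃ λ u → u ∈ X × m ≤ proj₁ u × (∀ {y} → (m , y) ∈ X → proj₂ u < y)
RightCellAboveMiddle m X = ∃ λ u → u ∈ X × m ≤ proj₁ u × (∀ {y} → (m , y) ∈ X → y < proj₂ u)

rotateBy : ℕ → ℕ → Cell → Cell
rotateBy p q u = (p ∸ proj₁ u , q ∸ proj₂ u)

translateBy : ℕ → ℕ → Cell → Cell
translateBy p e u = (proj₁ u + p , proj₂ u + e)

offLeftColumn? : Decidable (λ (c : Cell) → ¬ proj₁ c ≡ 0)
offLeftColumn? c = ¬? (proj₁ c ≟ 0)

lift : List Cell → ℕ
lift S = height S ∸ leftColHeight S

-- The 180° rotation of S placed to the left of S lifted by (lift S): the left column of the lifted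
-- copy (rows lift S … maxY S) coincides with the right column of the rotated one, so it is kept once.
glue : List Cell → List Cell
glue S = sortCells (suc (maxX S + maxX S)) (suc (maxY S + lift S))
  (map (rotateBy (maxX S) (maxY S)) S ++ map (translateBy (maxX S) (lift S)) (filter offLeftColumn? S))

module Glue {S} (dcp : IsDCP S) where
  p = maxX S
  q = maxY S
  c = leftColHeight S
  e = lift S
  X = glue S

  private
    sorted = proj₁ dcp
    o = proj₁ (proj₂ dcp)
    lc = proj₁ (proj₂ (proj₂ dcp))
    pred = proj₂ (proj₂ (proj₂ dcp))
    rowConvex = proj₁ (LocallyConvex⇒Convex lc)
    columnConvex = proj₂ (LocallyConvex⇒Convex lc)
    x≤maxX : ∀ {a b} → (a , b) ∈ S → a ≤ p
    x≤maxX = ≤maxOf proj₁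
    y≤maxY : ∀ {a b} → (a , b) ∈ S → b ≤ q
    y≤maxY = ≤maxOf proj₂
    leftColumn⇔ : ∀ y → (0 , y) ∈ S ⇔ y < c
    leftColumn⇔ = leftColumn-interval dcp
    e+c≡q+1 : e + c ≡ suc q
    e+c≡q+1 = m∸n+n≡m (leftColHeight≤height dcp)

  e≤q : e ≤ q
  e≤q = ≤-pred (subst (suc e ≤_) e+c≡q+1 (subst (_≤ e + c) (+-comm e 1) (+-monoʳ-≤ e (leftColHeight-pos dcp))))

  private
    q∸e<c : q ∸ e < c
    q∸e<c = subst (_≤ c) (+-∸-assoc 1 e≤q) (m≤n+o⇒m∸n≤o (suc q) e (≤-reflexive (sym e+c≡q+1)))

  -- Both copies of the left column of S occupy exactly the rows e … q of the shared column.
  rotatedLeftColumn⇔ : ∀ y → q ∸ y < c ⇔ e ≤ y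
  rotatedLeftColumn⇔ y = mk⇔
    (λ q∸y<c → +-cancelʳ-≤ c e y (begin
      e + c                ≡⟨ e+c≡q+1 ⟩
      suc q                ≤⟨ m≤n+m∸n (suc q) y ⟩
      y + (suc q ∸ y)      ≤⟨ +-monoʳ-≤ y (≤-trans (∸-suc-≤ q y) q∸y<c) ⟩
      y + c                ∎))
    (λ e≤y → ≤-<-trans (∸-monoʳ-≤ q e≤y) q∸e<c)
    where
    open ≤-Reasoning
    ∸-suc-≤ : ∀ q y → suc q ∸ y ≤ suc (q ∸ y)
    ∸-suc-≤ q zero = ≤-refl
    ∸-suc-≤ zero (suc y) = subst (_≤ 1) (sym (0∸n≡0 y)) z≤n
    ∸-suc-≤ (suc q) (suc y) = ∸-suc-≤ q y

  liftedLeftColumn⇔ : ∀ {y} → e ≤ y → y ∸ e < c ⇔ y ≤ q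
  liftedLeftColumn⇔ {y} e≤y = mk⇔
    (λ y∸e<c → ≤-pred (subst (suc y ≤_) (trans (+-comm c e) e+c≡q+1)
                        (subst (λ z → suc z ≤ c + e) (m∸n+n≡m e≤y) (+-monoˡ-≤ e y∸e<c))))
    (λ y≤q → ≤-<-trans (∸-monoˡ-≤ e y≤q) q∸e<c)

  Left Right InGlue : Cell → Set
  Left (x , y) = x ≤ p × y ≤ q × (p ∸ x , q ∸ y) ∈ S
  Right (x , y) = p ≤ x × e ≤ y × (x ∸ p , y ∸ e) ∈ S
  InGlue z = Left z ⊎ Right z

  left : ∀ {a b} → (a , b) ∈ S → InGlue (p ∸ a , q ∸ b)
  left {a} {b} ab∈S = inj₁ (m∸n≤m p a , m∸n≤m q b ,
    subst₂ (λ s t → (s , t) ∈ S) (sym (m∸[m∸n]≡n (x≤maxX ab∈S))) (sym (m∸[m∸n]≡n (y≤maxY ab∈S))) ab∈S)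

  right : ∀ {a b} → (a , b) ∈ S → InGlue (a + p , b + e)
  right {a} {b} ab∈S = inj₂ (m≤n+m p a , m≤n+m e b , subst₂ (λ s t → (s , t) ∈ S) (sym (m+n∸n≡m a p)) (sym (m+n∸n≡m b e)) ab∈S)

  sharedColumn⁺ : ∀ {y} → e ≤ y → y ≤ q → InGlue (p , y)
  sharedColumn⁺ {y} e≤y y≤q = inj₂ (≤-refl , e≤y ,
    subst (λ s → (s , y ∸ e) ∈ S) (sym (n∸n≡0 p)) (from (leftColumn⇔ (y ∸ e)) (from (liftedLeftColumn⇔ e≤y) y≤q)))

  sharedColumn⁻ : ∀ {y} → InGlue (p , y) → e ≤ y × y ≤ q
  sharedColumn⁻ {y} (inj₁ (_ , y≤q , y∈S)) =
    to (rotatedLeftColumn⇔ y) (to (leftColumn⇔ (q ∸ y)) (subst (λ s → (s , q ∸ y) ∈ S) (n∸n≡0 p) y∈S)) , y≤q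
  sharedColumn⁻ {y} (inj₂ (_ , e≤y , y∈S)) =
    e≤y , to (liftedLeftColumn⇔ e≤y) (to (leftColumn⇔ (y ∸ e)) (subst (λ s → (s , y ∸ e) ∈ S) (n∸n≡0 p) y∈S))

  private
    cells = map (rotateBy p q) S ++ map (translateBy p e) (filter offLeftColumn? S)

    InGlue⇒inBox : ∀ {z} → InGlue z → InBox (suc (p + p)) (suc (q + e)) z
    InGlue⇒inBox {x , y} (inj₁ (x≤p , y≤q , _)) = s≤s (≤-trans x≤p (m≤m+n p p)) , s≤s (≤-trans y≤q (m≤m+n q e))
    InGlue⇒inBox {x , y} (inj₂ (p≤x , e≤y , z∈S)) =
      s≤s (subst (_≤ p + p) (m∸n+n≡m p≤x) (+-monoˡ-≤ p (x≤maxX z∈S))) ,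
      s≤s (subst (_≤ q + e) (m∸n+n≡m e≤y) (+-monoˡ-≤ e (y≤maxY z∈S)))

    cells⁻ : ∀ {z} → z ∈ cells → InGlue z
    cells⁻ z∈ with ∈-++⁻ (map (rotateBy p q) S) z∈
    ... | inj₁ z∈rot with _ , ab∈S , refl ← ∈-map⁻ (rotateBy p q) z∈rot = left ab∈S
    ... | inj₂ z∈tr with _ , ab∈ , refl ← ∈-map⁻ (translateBy p e) z∈tr = right (proj₁ (∈-filter⁻ offLeftColumn? {xs = S} ab∈))

    cells⁺ˡ : ∀ {z} → Left z → z ∈ cells
    cells⁺ˡ {x , y} (x≤p , y≤q , z∈S) =
      subst (_∈ cells) (cong₂ _,_ (m∸[m∸n]≡n x≤p) (m∸[m∸n]≡n y≤q)) (∈-++⁺ˡ (∈-map⁺ (rotateBy p q) z∈S))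

    cells⁺ : ∀ {z} → InGlue z → z ∈ cells
    cells⁺ (inj₁ l) = cells⁺ˡ l
    cells⁺ {x , y} (inj₂ (p≤x , e≤y , z∈S)) with x ∸ p ≟ 0
    ... | no x≢p = subst (_∈ cells) (cong₂ _,_ (m∸n+n≡m p≤x) (m∸n+n≡m e≤y))
                     (∈-++⁺ʳ (map (rotateBy p q) S) (∈-map⁺ (translateBy p e) (∈-filter⁺ offLeftColumn? z∈S x≢p)))
    ... | yes x∸p≡0 with refl ← ≤-antisym (m∸n≡0⇒m≤n x∸p≡0) p≤x =
      cells⁺ˡ (≤-refl , y≤q , subst (λ s → (s , q ∸ y) ∈ S) (sym (n∸n≡0 p))
                                 (from (leftColumn⇔ (q ∸ y)) (from (rotatedLeftColumn⇔ y) e≤y)))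
      where y≤q = proj₂ (sharedColumn⁻ (inj₂ (p≤x , e≤y , z∈S)))

  glue⁻ : ∀ {z} → z ∈ X → InGlue z
  glue⁻ z∈X = cells⁻ (proj₁ (∈sortCells⁻ {suc (p + p)} {suc (q + e)} z∈X))

  glue⁺ : ∀ {z} → InGlue z → z ∈ X
  glue⁺ z∈ = ∈sortCells⁺ (cells⁺ z∈) (InGlue⇒inBox z∈)

  lowestShared : (p , e) ∈ X
  lowestShared = glue⁺ (sharedColumn⁺ ≤-refl e≤q)

  maxX-glue : maxX X ≡ p + p
  maxX-glue with _ , a∈S , refl ← maxOf-attained proj₁ o =
    maxOf-≡ proj₁ (λ z∈X → ≤-pred (proj₁ (InGlue⇒inBox (glue⁻ z∈X)))) (glue⁺ (right a∈S)) refl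

  maxY-glue : maxY X ≡ q + e
  maxY-glue with _ , b∈S , refl ← maxOf-attained proj₂ o =
    maxOf-≡ proj₂ (λ z∈X → ≤-pred (proj₂ (InGlue⇒inBox (glue⁻ z∈X)))) (glue⁺ (right b∈S)) refl

  length-glue : length X ≡ length S + length (filter offLeftColumn? S)
  length-glue = begin
    length X                                                           ≡⟨ length-sortCells unique InGlue⇒inBox∘cells⁻ ⟩
    length cells                                                       ≡⟨ length-++ (map (rotateBy p q) S) ⟩
    length (map (rotateBy p q) S) + length (map (translateBy p e) (filter offLeftColumn? S))
                                                                       ≡⟨ cong₂ _+_ (length-map _ S) (length-map _ (filter offLeftColumn? S)) ⟩
    length S + length (filter offLeftColumn? S)                        ∎
    where
    open ≡-Reasoning
    InGlue⇒inBox∘cells⁻ : ∀ {z} → z ∈ cells → InBox (suc (p + p)) (suc (q + e)) z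
    InGlue⇒inBox∘cells⁻ z∈ = InGlue⇒inBox (cells⁻ z∈)
    uS = Sorted⇒Unique sorted
    rotate-injective : ∀ {u v} → u ∈ S → v ∈ S → rotateBy p q u ≡ rotateBy p q v → u ≡ v
    rotate-injective u∈S v∈S eq = cong₂ _,_ (∸-cancelˡ-≡ (x≤maxX u∈S) (x≤maxX v∈S) (cong proj₁ eq))
                                            (∸-cancelˡ-≡ (y≤maxY u∈S) (y≤maxY v∈S) (cong proj₂ eq))
    translate-injective : ∀ {u v} → u ∈ filter offLeftColumn? S → v ∈ filter offLeftColumn? S →
                          translateBy p e u ≡ translateBy p e v → u ≡ v
    translate-injective _ _ eq = cong₂ _,_ (+-cancelʳ-≡ p _ _ (cong proj₁ eq)) (+-cancelʳ-≡ e _ _ (cong proj₂ eq))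
    disjoint : ∀ {v} → ¬ (v ∈ map (rotateBy p q) S × v ∈ map (translateBy p e) (filter offLeftColumn? S))
    disjoint (v∈rot , v∈tr)
      with (a , _) , _ , refl ← ∈-map⁻ (rotateBy p q) v∈rot
      with (a′ , _) , a′∈ , eq ← ∈-map⁻ (translateBy p e) v∈tr =
      proj₂ (∈-filter⁻ offLeftColumn? {xs = S} a′∈) (n≤0⇒n≡0 (+-cancelʳ-≤ p a′ 0 (subst (_≤ p) (cong proj₁ eq) (m∸n≤m p a))))
    unique : Unique cells
    unique = Unique.++⁺ (unique-map⁺-on (rotateBy p q) uS rotate-injective)
                        (unique-map⁺-on (translateBy p e) (Unique.filter⁺ offLeftColumn? uS) translate-injective) disjoint

  private
    rowConvex-glue : ∀ y a b c′ → InGlue (a , y) → InGlue (c′ , y) → a ≤ b → b ≤ c′ → InGlue (b , y)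
    rowConvex-glue y a b c′ a∈ c∈ a≤b b≤c with ≤-total b p
    rowConvex-glue y a b c′ (inj₁ (_ , y≤q , a∈S)) (inj₁ (_ , _ , c∈S)) a≤b b≤c | inj₁ b≤p =
      inj₁ (b≤p , y≤q , rowConvex (q ∸ y) (p ∸ c′) (p ∸ b) (p ∸ a) c∈S a∈S (∸-monoʳ-≤ p b≤c) (∸-monoʳ-≤ p a≤b))
    rowConvex-glue y a b c′ (inj₁ (_ , y≤q , a∈S)) (inj₂ (_ , e≤y , _)) a≤b b≤c | inj₁ b≤p =
      inj₁ (b≤p , y≤q , rowConvex (q ∸ y) 0 (p ∸ b) (p ∸ a)
                          (from (leftColumn⇔ (q ∸ y)) (from (rotatedLeftColumn⇔ y) e≤y)) a∈S z≤n (∸-monoʳ-≤ p a≤b))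
    rowConvex-glue y a b c′ (inj₂ r@(p≤a , _ , _)) _ a≤b b≤c | inj₁ b≤p =
      subst (λ s → InGlue (s , y)) (≤-antisym a≤b (≤-trans b≤p p≤a)) (inj₂ r)
    rowConvex-glue y a b c′ (inj₂ (_ , _ , a∈S)) (inj₂ (_ , e≤y , c∈S)) a≤b b≤c | inj₂ p≤b =
      inj₂ (p≤b , e≤y , rowConvex (y ∸ e) (a ∸ p) (b ∸ p) (c′ ∸ p) a∈S c∈S (∸-monoˡ-≤ p a≤b) (∸-monoˡ-≤ p b≤c))
    rowConvex-glue y a b c′ (inj₁ (_ , y≤q , _)) (inj₂ (_ , e≤y , c∈S)) a≤b b≤c | inj₂ p≤b =
      inj₂ (p≤b , e≤y , rowConvex (y ∸ e) 0 (b ∸ p) (c′ ∸ p)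
                          (from (leftColumn⇔ (y ∸ e)) (from (liftedLeftColumn⇔ e≤y) y≤q)) c∈S z≤n (∸-monoˡ-≤ p b≤c))
    rowConvex-glue y a b c′ _ (inj₁ l@(c≤p , _ , _)) a≤b b≤c | inj₂ p≤b =
      subst (λ s → InGlue (s , y)) (≤-antisym (≤-trans c≤p p≤b) b≤c) (inj₁ l)

    columnConvex-glue : ∀ x a b c′ → InGlue (x , a) → InGlue (x , c′) → a ≤ b → b ≤ c′ → InGlue (x , b)
    columnConvex-glue x a b c′ a∈ c∈ a≤b b≤c with <-cmp x p
    columnConvex-glue x a b c′ (inj₁ (x≤p , _ , a∈S)) (inj₁ (_ , c≤q , c∈S)) a≤b b≤c | tri< _ _ _ =
      inj₁ (x≤p , ≤-trans b≤c c≤q , columnConvex (p ∸ x) (q ∸ c′) (q ∸ b) (q ∸ a) c∈S a∈S (∸-monoʳ-≤ q b≤c) (∸-monoʳ-≤ q a≤b))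
    columnConvex-glue x a b c′ (inj₂ (p≤x , _ , _)) _ a≤b b≤c | tri< x<p _ _ = ⊥-elim (<⇒≱ x<p p≤x)
    columnConvex-glue x a b c′ _ (inj₂ (p≤x , _ , _)) a≤b b≤c | tri< x<p _ _ = ⊥-elim (<⇒≱ x<p p≤x)
    columnConvex-glue x a b c′ a∈ c∈ a≤b b≤c | tri≈ _ refl _ =
      sharedColumn⁺ (≤-trans (proj₁ (sharedColumn⁻ a∈)) a≤b) (≤-trans b≤c (proj₂ (sharedColumn⁻ c∈)))
    columnConvex-glue x a b c′ (inj₂ (p≤x , e≤a , a∈S)) (inj₂ (_ , _ , c∈S)) a≤b b≤c | tri> _ _ _ =
      inj₂ (p≤x , ≤-trans e≤a a≤b , columnConvex (x ∸ p) (a ∸ e) (b ∸ e) (c′ ∸ e) a∈S c∈S (∸-monoˡ-≤ e a≤b) (∸-monoˡ-≤ e b≤c))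
    columnConvex-glue x a b c′ (inj₁ (x≤p , _ , _)) _ a≤b b≤c | tri> _ _ p<x = ⊥-elim (<⇒≱ p<x x≤p)
    columnConvex-glue x a b c′ _ (inj₁ (x≤p , _ , _)) a≤b b≤c | tri> _ _ p<x = ⊥-elim (<⇒≱ p<x x≤p)

  glue-convex : Convex X
  glue-convex = (λ y a b c′ a∈X c∈X a≤b b≤c → glue⁺ (rowConvex-glue y a b c′ (glue⁻ a∈X) (glue⁻ c∈X) a≤b b≤c)) ,
                (λ x a b c′ a∈X c∈X a≤b b≤c → glue⁺ (columnConvex-glue x a b c′ (glue⁻ a∈X) (glue⁻ c∈X) a≤b b≤c))

  -- Every cell is reached from the bottom (p , e) of the shared column: cells of the lifted copy by
  -- lifting a north-east path of S, cells of the rotated copy from the top (p , q) by rotating one.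
  private
    path-in-S : ∀ {u} → u ∈ S → Path S (0 , 0) u
    path-in-S = NEPath⇒Path ∘ hasPredecessors⇒NEPath pred

    sharedColumn-path : Path X (p , e) (p , q)
    sharedColumn-path = subst (λ s → Path X (p , e) (p , s)) (m∸n+n≡m e≤q)
      (verticalPath p e (q ∸ e) λ {j} j≤ → glue⁺ (sharedColumn⁺ (m≤n+m e j) (subst (j + e ≤_) (m∸n+n≡m e≤q) (+-monoˡ-≤ e j≤))))

    path-from-base : ∀ {z} → z ∈ X → Path X (p , e) z
    path-from-base {x , y} z∈X with glue⁻ z∈X
    ... | inj₂ (p≤x , e≤y , z∈S) = subst (Path X (p , e)) (cong₂ _,_ (m∸n+n≡m p≤x) (m∸n+n≡m e≤y))
          (Path-map (translateBy p e) (glue⁺ ∘ right) (λ _ _ → Adj-translate p e) (path-in-S z∈S))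
    ... | inj₁ (x≤p , y≤q , z∈S) = sharedColumn-path ++ₚ subst (Path X (p , q)) (cong₂ _,_ (m∸[m∸n]≡n x≤p) (m∸[m∸n]≡n y≤q))
          (Path-map (rotateBy p q) (glue⁺ ∘ left)
             (λ u∈S v∈S adj → Adj-reflectY q (Adj-reflectX p adj (x≤maxX u∈S) (x≤maxX v∈S)) (y≤maxY u∈S) (y≤maxY v∈S))
             (path-in-S z∈S))

  glue-polyomino : IsPolyomino X
  glue-polyomino = record
    { sorted = sortCells-sorted (suc (p + p)) (suc (q + e)) cells
    ; nonempty = ∈⇒nonempty lowestShared
    ; leftAligned = leftAligned
    ; bottomAligned = bottomAligned
    ; connected = connected-via (p , e) path-from-base
    }
    where
    leftAligned : ∃ λ y → (0 , y) ∈ X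
    leftAligned with (_ , b) , a∈S , refl ← maxOf-attained proj₁ o = q ∸ b , subst (λ s → (s , q ∸ b) ∈ X) (n∸n≡0 p) (glue⁺ (left a∈S))
    bottomAligned : ∃ λ x → (x , 0) ∈ X
    bottomAligned with (a , _) , b∈S , refl ← maxOf-attained proj₂ o = p ∸ a , subst (λ s → (p ∸ a , s) ∈ X) (n∸n≡0 q) (glue⁺ (left b∈S))

  glue-rotationClosed : RotationClosed X
  glue-rotationClosed {x} {y} z∈X rewrite maxX-glue | maxY-glue with glue⁻ z∈X
  ... | inj₁ (x≤p , y≤q , z∈S) = glue⁺ (subst₂ (λ s t → InGlue (s , t))
          (sym (trans (+-∸-assoc p x≤p) (+-comm p (p ∸ x)))) (sym (+-∸-comm e y≤q)) (right z∈S))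
  ... | inj₂ (p≤x , e≤y , z∈S) = glue⁺ (subst₂ (λ s t → InGlue (s , t))
          (sym (trans (cong ((p + p) ∸_) (sym (m+[n∸m]≡n p≤x))) ([m+n]∸[m+o]≡n∸o p p (x ∸ p))))
          (sym (trans (cong₂ _∸_ (+-comm q e) (sym (m+[n∸m]≡n e≤y))) ([m+n]∸[m+o]≡n∸o e q (y ∸ e))))
          (left z∈S))

  glue-rightHalf-above : ∀ {x y} → (x , y) ∈ X → p ≤ x → e ≤ y
  glue-rightHalf-above z∈X p≤x with glue⁻ z∈X
  ... | inj₂ (_ , e≤y , _) = e≤y
  ... | inj₁ l@(x≤p , _ , _) with refl ← ≤-antisym x≤p p≤x = proj₁ (sharedColumn⁻ (inj₁ l))

  right⁻ : ∀ {a b} → (a + p , b + e) ∈ X → (a , b) ∈ S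
  right⁻ {a} {b} z∈X with glue⁻ z∈X
  ... | inj₂ (_ , _ , z∈S) = subst₂ (λ s t → (s , t) ∈ S) (m+n∸n≡m a p) (m+n∸n≡m b e) z∈S
  ... | inj₁ (a+p≤p , b+e≤q , _) with refl ← n≤0⇒n≡0 (+-cancelʳ-≤ p a 0 a+p≤p) =
    from (leftColumn⇔ b) (≤-<-trans (m+n≤o⇒m≤o∸n b b+e≤q) q∸e<c)

  glue-noRightCellBelowMiddle : ¬ RightCellBelowMiddle p X
  glue-noRightCellBelowMiddle (_ , z∈X , p≤x , below) = <⇒≱ (below lowestShared) (glue-rightHalf-above z∈X p≤x)

  glue-rightCellAboveMiddle : ¬ LeftColumnFull S → RightCellAboveMiddle p X
  glue-rightCellAboveMiddle notFull with (a , _) , top∈S , refl ← maxOf-attained proj₂ o =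
    (a + p , q + e) , glue⁺ (right top∈S) , m≤n+m p a ,
    λ y∈X → ≤-<-trans (proj₂ (sharedColumn⁻ (glue⁻ y∈X))) (m<m+n q (m<n⇒0<n∸m (≤∧≢⇒< (leftColHeight≤height dcp) notFull)))

  private
    2*width : 2 * width S ≡ suc (width X)
    2*width = begin
      2 * width S              ≡⟨ 2*n≡n+n (suc p) ⟩
      suc p + suc p            ≡⟨ cong suc (+-suc p p) ⟩
      suc (suc (p + p))        ≡⟨ cong (suc ∘ suc) (sym maxX-glue) ⟩
      suc (width X)            ∎
      where open ≡-Reasoning
    2*height : 2 * height S ≡ height X + c
    2*height = begin
      2 * height S             ≡⟨ 2*n≡n+n (suc q) ⟩
      suc q + suc q            ≡⟨ cong (λ h → suc (q + h)) (sym e+c≡q+1) ⟩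
      suc (q + (e + c))        ≡⟨ cong suc (sym (+-assoc q e c)) ⟩
      suc (q + e + c)          ≡⟨ cong (λ h → suc h + c) (sym maxY-glue) ⟩
      height X + c             ∎
      where open ≡-Reasoning
    2*area : 2 * area S ≡ area X + c
    2*area = begin
      2 * area S                                            ≡⟨ 2*n≡n+n (length S) ⟩
      length S + length S                                   ≡⟨ cong (length S +_) (sym (length-filter-∁ (λ c → proj₁ c ≟ 0) S)) ⟩
      length S + (c + length (filter offLeftColumn? S))     ≡⟨ cong (length S +_) (+-comm c _) ⟩
      length S + (length (filter offLeftColumn? S) + c)     ≡⟨ sym (+-assoc (length S) _ c) ⟩
      length S + length (filter offLeftColumn? S) + c       ≡⟨ cong (_+ c) (sym length-glue) ⟩
      length X + c                                          ∎
      where open ≡-Reasoning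

  glue-sizes⇔ : ∀ {W H A} → (2 * width S ≡ suc W × 2 * height S ≡ H + c × 2 * area S ≡ A + c) ⇔
                            (width X ≡ W × height X ≡ H × area X ≡ A)
  glue-sizes⇔ = mk⇔
    (λ (2w≡ , 2h≡ , 2a≡) → suc-injective (trans (sym 2*width) 2w≡) ,
       +-cancelʳ-≡ c _ _ (trans (sym 2*height) 2h≡) , +-cancelʳ-≡ c _ _ (trans (sym 2*area) 2a≡))
    (λ (w≡ , h≡ , a≡) → trans 2*width (cong suc w≡) , trans 2*height (cong (_+ c) h≡) , trans 2*area (cong (_+ c) a≡))

  glue-FClass : ∀ {W H A} → DClass (suc W) H A S → FClass W H A X
  glue-FClass (_ , sizes) =
    (glue-polyomino , glue-convex) , from RotInvariant⇔RotationClosed glue-rotationClosed ,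
    (p , cong suc (trans maxX-glue (cong (p +_) (sym (+-identityʳ p))))) , to glue-sizes⇔ sizes

-- Reflection

reflectCell : ℕ → Cell → Cell
reflectCell Q u = (proj₁ u , Q ∸ proj₂ u)

reflect : List Cell → List Cell
reflect X = sortCells (width X) (height X) (map (reflectCell (maxY X)) X)

module Reflect {X} (P : IsPolyomino X) where
  Q = maxY X
  Y = reflect X

  private
    y≤maxY : ∀ {a b} → (a , b) ∈ X → b ≤ Q
    y≤maxY = ≤maxOf proj₂
    left∈X = proj₂ (IsPolyomino.leftAligned P)

  reflect⁺ : ∀ {x y} → (x , y) ∈ X → (x , Q ∸ y) ∈ Y
  reflect⁺ {x} {y} z∈X = ∈sortCells⁺ (∈-map⁺ (reflectCell Q) z∈X) (x<width z∈X , s≤s (m∸n≤m Q y))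

  reflect⁻ : ∀ {x y} → (x , y) ∈ Y → y ≤ Q × (x , Q ∸ y) ∈ X
  reflect⁻ {x} {y} z∈Y
    with (a , b) , z∈X , refl ← ∈-map⁻ (reflectCell Q) (proj₁ (∈sortCells⁻ {width X} {height X} {map (reflectCell Q) X} z∈Y)) =
    m∸n≤m Q b , subst (λ s → (a , s) ∈ X) (sym (m∸[m∸n]≡n (y≤maxY z∈X))) z∈X

  reflect⁺′ : ∀ {x y} → y ≤ Q → (x , Q ∸ y) ∈ X → (x , y) ∈ Y
  reflect⁺′ {x} y≤Q z∈X = subst (λ s → (x , s) ∈ Y) (m∸[m∸n]≡n y≤Q) (reflect⁺ z∈X)

  maxX-reflect : maxX Y ≡ maxX X
  maxX-reflect with _ , z∈X , refl ← maxOf-attained proj₁ left∈X =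
    maxOf-≡ proj₁ (λ {(x , y)} z∈Y → ≤maxOf proj₁ (proj₂ (reflect⁻ z∈Y))) (reflect⁺ z∈X) refl

  maxY-reflect : maxY Y ≡ Q
  maxY-reflect = maxOf-≡ proj₂ (λ {(x , y)} z∈Y → proj₁ (reflect⁻ z∈Y)) (reflect⁺ (proj₂ (IsPolyomino.bottomAligned P))) refl

  reflect-polyomino : IsPolyomino Y
  reflect-polyomino = record
    { sorted = sortCells-sorted (width X) (height X) (map (reflectCell Q) X)
    ; nonempty = ∈⇒nonempty (reflect⁺ left∈X)
    ; leftAligned = _ , reflect⁺ left∈X
    ; bottomAligned = bottomAligned
    ; connected = connected
    }
    where
    bottomAligned : ∃ λ x → (x , 0) ∈ Y
    bottomAligned with (a , _) , top∈X , refl ← maxOf-attained proj₂ left∈X = a , subst (λ s → (a , s) ∈ Y) (n∸n≡0 Q) (reflect⁺ top∈X)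
    connected : ∀ {c d} → c ∈ Y → d ∈ Y → Path Y c d
    connected {x , y} {x′ , y′} c∈Y d∈Y with y≤Q , c∈X ← reflect⁻ c∈Y | y′≤Q , d∈X ← reflect⁻ d∈Y =
      subst₂ (Path Y) (cong (x ,_) (m∸[m∸n]≡n y≤Q)) (cong (x′ ,_) (m∸[m∸n]≡n y′≤Q))
        (Path-map (reflectCell Q) reflect⁺ (λ u∈X v∈X adj → Adj-reflectY Q adj (y≤maxY u∈X) (y≤maxY v∈X))
          (IsPolyomino.connected P c∈X d∈X))

  reflect-convex : Convex X → Convex Y
  reflect-convex (rowConvex , columnConvex) =
    (λ y a b c a∈Y c∈Y a≤b b≤c → reflect⁺′ (proj₁ (reflect⁻ a∈Y))
       (rowConvex (Q ∸ y) a b c (proj₂ (reflect⁻ a∈Y)) (proj₂ (reflect⁻ c∈Y)) a≤b b≤c)) ,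
    (λ x a b c a∈Y c∈Y a≤b b≤c → reflect⁺′ (≤-trans b≤c (proj₁ (reflect⁻ c∈Y)))
       (columnConvex x (Q ∸ c) (Q ∸ b) (Q ∸ a) (proj₂ (reflect⁻ c∈Y)) (proj₂ (reflect⁻ a∈Y)) (∸-monoʳ-≤ Q b≤c) (∸-monoʳ-≤ Q a≤b)))

  reflect-rotationClosed : RotationClosed X → RotationClosed Y
  reflect-rotationClosed closed {x} {y} z∈Y rewrite maxX-reflect | maxY-reflect =
    reflect⁺′ (m∸n≤m Q y) (closed (proj₂ (reflect⁻ z∈Y)))

  length-reflect : length Y ≡ length X
  length-reflect = trans (length-sortCells (unique-map⁺-on (reflectCell Q) (Sorted⇒Unique (IsPolyomino.sorted P)) injective) inBox)
                         (length-map (reflectCell Q) X)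
    where
    injective : ∀ {u v} → u ∈ X → v ∈ X → reflectCell Q u ≡ reflectCell Q v → u ≡ v
    injective u∈X v∈X eq = cong₂ _,_ (cong proj₁ eq) (∸-cancelˡ-≡ (y≤maxY u∈X) (y≤maxY v∈X) (cong proj₂ eq))
    inBox : ∀ {z} → z ∈ map (reflectCell Q) X → InBox (width X) (height X) z
    inBox z∈ with (_ , b) , z∈X , refl ← ∈-map⁻ (reflectCell Q) z∈ = x<width z∈X , s≤s (m∸n≤m Q b)

  reflect-aboveMiddle⇒belowMiddle : ∀ {m} → RightCellAboveMiddle m X → RightCellBelowMiddle m Y
  reflect-aboveMiddle⇒belowMiddle {m} ((x , y) , z∈X , m≤x , above) = (x , Q ∸ y) , reflect⁺ z∈X , m≤x , below
    where
    below : ∀ {y′} → (m , y′) ∈ Y → Q ∸ y < y′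
    below {y′} y′∈Y with y′ ≤? Q ∸ y
    ... | no y′≰ = ≰⇒> y′≰
    ... | yes y′≤ = ⊥-elim (<⇒≱ (above (proj₂ (reflect⁻ y′∈Y)))
                              (subst (_≤ Q ∸ y′) (m∸[m∸n]≡n (y≤maxY z∈X)) (∸-monoʳ-≤ Q y′≤)))

  reflect-FClass : ∀ {W H A} → FClass W H A X → FClass W H A Y
  reflect-FClass ((_ , cv) , ri , (k , odd) , w≡ , h≡ , a≡) =
    (reflect-polyomino , reflect-convex cv) ,
    from RotInvariant⇔RotationClosed (reflect-rotationClosed (to RotInvariant⇔RotationClosed ri)) ,
    (k , trans (cong suc maxX-reflect) odd) ,
    trans (cong suc maxX-reflect) w≡ , trans (cong suc maxY-reflect) h≡ , trans length-reflect a≡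

reflect-involutive : ∀ {X} → IsPolyomino X → reflect (reflect X) ≡ X
reflect-involutive {X} P = sorted-set⇒≡ (IsPolyomino.sorted R₂.reflect-polyomino) (IsPolyomino.sorted P) (mk⇔ into back)
  where
  module R₁ = Reflect P
  module R₂ = Reflect R₁.reflect-polyomino
  into : ∀ {c} → c ∈ reflect (reflect X) → c ∈ X
  into {x , y} c∈ with y≤ , c∈Y ← R₂.reflect⁻ c∈ rewrite R₁.maxY-reflect with _ , c∈X ← R₁.reflect⁻ c∈Y =
    subst (λ s → (x , s) ∈ X) (m∸[m∸n]≡n y≤) c∈X
  back : ∀ {c} → c ∈ X → c ∈ reflect (reflect X)
  back {x , y} c∈X = subst (λ s → (x , s) ∈ reflect (reflect X))
    (trans (cong (_∸ (R₁.Q ∸ y)) R₁.maxY-reflect) (m∸[m∸n]≡n (≤maxOf proj₂ c∈X))) (R₂.reflect⁺ (R₁.reflect⁺ c∈X))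

-- Cutting along the middle column

least : ∀ {P : ℕ → Set} → Decidable P → ∀ {n} → P n → ∃ λ d → P d × (∀ {y} → P y → d ≤ y)
least {P} P? {n} Pn = search n 0 (+-identityʳ n) (λ ())
  where
  search : ∀ k i → k + i ≡ n → (∀ {y} → y < i → ¬ P y) → ∃ λ d → P d × (∀ {y} → P y → d ≤ y)
  search k i k+i≡n none-below with P? i
  ... | yes Pi = i , Pi , λ Py → ≮⇒≥ (λ y<i → none-below y<i Py)
  search zero i refl none-below | no ¬Pi = ⊥-elim (¬Pi Pn)
  search (suc k) i k+i≡n none-below | no ¬Pi = search k (suc i) (trans (+-suc k i) k+i≡n) none-below′
    where
    none-below′ : ∀ {y} → y < suc i → ¬ P y
    none-below′ y<1+i with m<1+n⇒m<n∨m≡n y<1+i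
    ... | inj₁ y<i = none-below y<i
    ... | inj₂ refl = ¬Pi

module MiddleColumn {X} (P : IsPolyomino X) (cv : Convex X) (closed : RotationClosed X)
                    {m} (maxX≡ : maxX X ≡ m + m) {d} (d∈X : (m , d) ∈ X) (d-min : ∀ {y} → (m , y) ∈ X → d ≤ y) where
  Q = maxY X
  T = Q ∸ d

  private
    rowConvex = proj₁ cv
    columnConvex = proj₂ cv
    x≤2m : ∀ {x y} → (x , y) ∈ X → x ≤ m + m
    x≤2m z∈X = subst (_ ≤_) maxX≡ (≤maxOf proj₁ z∈X)
    y≤Q : ∀ {x y} → (x , y) ∈ X → y ≤ Q
    y≤Q = ≤maxOf proj₂

  rotate∈ : ∀ {x y} → (x , y) ∈ X → ((m + m) ∸ x , Q ∸ y) ∈ X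
  rotate∈ {x} {y} z∈X = subst (λ s → (s ∸ x , Q ∸ y) ∈ X) maxX≡ (closed z∈X)

  middle-symmetric : ∀ {y} → (m , y) ∈ X → (m , Q ∸ y) ∈ X
  middle-symmetric {y} z∈X = subst (λ s → (s , Q ∸ y) ∈ X) (m+n∸m≡n m m) (rotate∈ z∈X)

  d≤T : d ≤ T
  d≤T = d-min (middle-symmetric d∈X)

  d≤Q : d ≤ Q
  d≤Q = ≤-trans d≤T (m∸n≤m Q d)

  T+d≡Q : T + d ≡ Q
  T+d≡Q = m∸n+n≡m d≤Q

  middle≤T : ∀ {y} → (m , y) ∈ X → y ≤ T
  middle≤T {y} z∈X = m+n≤o⇒m≤o∸n y (subst (_≤ Q) (+-comm d y) (m≤o∸n⇒m+n≤o d (y≤Q z∈X) (d-min (middle-symmetric z∈X))))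

  middle⁺ : ∀ {y} → d ≤ y → y ≤ T → (m , y) ∈ X
  middle⁺ d≤y y≤T = columnConvex m _ _ _ d∈X (middle-symmetric d∈X) d≤y y≤T

  RightHalfAbove : Set
  RightHalfAbove = ∀ {x y} → (x , y) ∈ X → m ≤ x → d ≤ y

  -- If y > T, the row y₁ ⊔ (Q ∸ y) < d through (x₁ , y₁) and the rotation of (x , y) meets the middle column.
  rightHalf-belowTop : ∀ {x₁ y₁} → (x₁ , y₁) ∈ X → m ≤ x₁ → y₁ < d → ∀ {x y} → (x , y) ∈ X → m ≤ x → y ≤ T
  rightHalf-belowTop {x₁} {y₁} z₁∈X m≤x₁ y₁<d {x} {y} z∈X m≤x with y ≤? T
  ... | yes y≤T = y≤T
  ... | no y≰T =
    let x′ , _ , x′≤m , x′∈X = row-meets P cv (subst ((m + m) ∸ x ≤_) (m+n∸m≡n m m) (∸-monoʳ-≤ (m + m) m≤x))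
                                           (rotate∈ z∈X) d∈X (inj₁ (m≤n⊔m y₁ z , <⇒≤ Y<d))
        x″ , m≤x″ , _ , x″∈X = row-meets P cv m≤x₁ d∈X z₁∈X (inj₂ (m≤m⊔n y₁ z , <⇒≤ Y<d))
    in ⊥-elim (<⇒≱ Y<d (d-min (rowConvex Y x′ m x″ x′∈X x″∈X x′≤m m≤x″)))
    where
    z = Q ∸ y
    z<d : z < d
    z<d = subst (z <_) (m∸[m∸n]≡n d≤Q) (∸-monoʳ-< (≰⇒> y≰T) (y≤Q z∈X))
    Y = y₁ ⊔ z
    Y<d : Y < d
    Y<d = ⊔-lub y₁<d z<d

  shift : Cell → Cell
  shift u = (proj₁ u + m , proj₂ u + d)

  rightHalf : List Cell
  rightHalf = filter (λ u → shift u ∈? X) (box (suc m) (suc T))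

  ∈rightHalf⁻ : ∀ {a b} → (a , b) ∈ rightHalf → a ≤ m × (a + m , b + d) ∈ X
  ∈rightHalf⁻ u∈ with u∈box , u∈X ← ∈-filter⁻ (λ u → shift u ∈? X) {xs = box (suc m) (suc T)} u∈ =
    ≤-pred (proj₁ (∈box⁻ _ u∈box)) , u∈X

  ∈rightHalf⁺ : ∀ {a b} → a ≤ m → (a + m , b + d) ∈ X → (a , b) ∈ rightHalf
  ∈rightHalf⁺ {a} {b} a≤m u∈X = ∈-filter⁺ (λ u → shift u ∈? X) (∈box⁺ (s≤s a≤m , s≤s (m+n≤o⇒m≤o∸n b (y≤Q u∈X)))) u∈X

  rightHalf-convex : Convex rightHalf
  rightHalf-convex =
    (λ y a b c a∈ c∈ a≤b b≤c → ∈rightHalf⁺ (≤-trans b≤c (proj₁ (∈rightHalf⁻ c∈)))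
       (rowConvex (y + d) (a + m) (b + m) (c + m) (proj₂ (∈rightHalf⁻ a∈)) (proj₂ (∈rightHalf⁻ c∈)) (+-monoˡ-≤ m a≤b) (+-monoˡ-≤ m b≤c))) ,
    (λ x a b c a∈ c∈ a≤b b≤c → ∈rightHalf⁺ (proj₁ (∈rightHalf⁻ a∈))
       (columnConvex (x + m) (a + d) (b + d) (c + d) (proj₂ (∈rightHalf⁻ a∈)) (proj₂ (∈rightHalf⁻ c∈)) (+-monoˡ-≤ d a≤b) (+-monoˡ-≤ d b≤c)))

  -- A cell of the right half without west and south neighbours would leave a gap in its row:
  -- that row meets a column between the middle one and the cell's.
  rightHalf-hasPredecessor : ∀ {u} → u ∈ rightHalf → HasPredecessor rightHalf u
  rightHalf-hasPredecessor {zero , zero} _ = tt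
  rightHalf-hasPredecessor {suc a , zero} u∈ with a<m , u∈X ← ∈rightHalf⁻ u∈ =
    ∈rightHalf⁺ (≤-trans (n≤1+n a) a<m) (rowConvex d m (a + m) (suc a + m) d∈X u∈X (m≤n+m m a) (n≤1+n (a + m)))
  rightHalf-hasPredecessor {zero , suc b} u∈ with _ , u∈X ← ∈rightHalf⁻ u∈ =
    ∈rightHalf⁺ z≤n (columnConvex m d (b + d) (suc b + d) d∈X u∈X (m≤n+m d b) (n≤1+n (b + d)))
  rightHalf-hasPredecessor {suc a , suc b} u∈ with (a , suc b) ∈? rightHalf | (suc a , b) ∈? rightHalf
  ... | yes west∈ | _ = inj₁ west∈
  ... | no _ | yes south∈ = inj₂ south∈
  ... | no west∉ | no south∉ = ⊥-elim (west∉ (∈rightHalf⁺ (≤-trans (n≤1+n a) a<m) west∈X))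
    where
    a<m = proj₁ (∈rightHalf⁻ u∈)
    u∈X = proj₂ (∈rightHalf⁻ u∈)
    j = a + m
    Y = suc (b + d)
    shared = adjacentColumns-overlap P j (subst (j <_) (sym maxX≡) (+-monoˡ-< m a<m))
    r = proj₁ shared
    Y≤r : Y ≤ r
    Y≤r with Y ≤? r
    ... | yes Y≤r = Y≤r
    ... | no Y≰r = ⊥-elim (south∉ (∈rightHalf⁺ a<m
            (columnConvex (suc j) r (b + d) Y (proj₂ (proj₂ shared)) u∈X (≤-pred (≰⇒> Y≰r)) (n≤1+n (b + d)))))
    west∈X : (j , Y) ∈ X
    west∈X with x , _ , x≤j , x∈X ← row-meets P cv (m≤n+m m a) d∈X (proj₁ (proj₂ shared))
                                      (inj₁ (≤-trans (m≤n+m d b) (n≤1+n (b + d)) , Y≤r)) =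
      rowConvex Y x j (suc j) x∈X u∈X x≤j (n≤1+n j)

  rightHalf-DCP : IsDCP rightHalf
  rightHalf-DCP = Linked.filter⁺ (λ u → shift u ∈? X) <ᶜ-trans (box-sorted (suc m) (suc T)) , ∈rightHalf⁺ z≤n d∈X ,
                  Convex⇒LocallyConvex rightHalf-convex , rightHalf-hasPredecessor

  leftColHeight-rightHalf : leftColHeight rightHalf ≡ suc (T ∸ d)
  leftColHeight-rightHalf = leftColHeight-≡ (Sorted⇒Unique (proj₁ rightHalf-DCP)) λ b → mk⇔
    (λ b∈ → s≤s (m+n≤o⇒m≤o∸n b (middle≤T (proj₂ (∈rightHalf⁻ b∈)))))
    (λ b≤T∸d → ∈rightHalf⁺ z≤n (middle⁺ (m≤n+m d b) (m≤o∸n⇒m+n≤o b d≤T (≤-pred b≤T∸d))))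

  module _ (above : RightHalfAbove) where
    maxX-rightHalf : maxX rightHalf ≡ m
    maxX-rightHalf with (x , y) , z∈X , x≡ ← maxOf-attained proj₁ d∈X =
      maxOf-≡ proj₁ (λ u∈ → proj₁ (∈rightHalf⁻ u∈)) (∈rightHalf⁺ ≤-refl z′∈X) refl
      where
      x≡2m = trans x≡ maxX≡
      d≤y = above z∈X (subst (m ≤_) (sym x≡2m) (m≤m+n m m))
      z′∈X : (m + m , (y ∸ d) + d) ∈ X
      z′∈X = subst₂ (λ s t → (s , t) ∈ X) x≡2m (sym (m∸n+n≡m d≤y)) z∈X

    maxY-rightHalf : maxY rightHalf ≡ T
    maxY-rightHalf with x₀ , bottom∈X ← IsPolyomino.bottomAligned P | x₀ ≤? m
    ... | yes x₀≤m = maxOf-≡ proj₂ (λ u∈ → m+n≤o⇒m≤o∸n _ (y≤Q (proj₂ (∈rightHalf⁻ u∈)))) (∈rightHalf⁺ (m∸n≤m m x₀) top∈X) refl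
      where
      top∈X : ((m ∸ x₀) + m , T + d) ∈ X
      top∈X = subst₂ (λ s t → (s , t) ∈ X) (trans (+-∸-assoc m x₀≤m) (+-comm m (m ∸ x₀))) (sym T+d≡Q) (rotate∈ bottom∈X)
    ... | no x₀≰m = maxOf-≡ proj₂ (λ u∈ → m+n≤o⇒m≤o∸n _ (y≤Q (proj₂ (∈rightHalf⁻ u∈)))) (∈rightHalf⁺ z≤n top∈X) refl
      where
      d≡0 : d ≡ 0
      d≡0 = n≤0⇒n≡0 (above bottom∈X (<⇒≤ (≰⇒> x₀≰m)))
      top∈X : (m , T + d) ∈ X
      top∈X = subst (λ t → (m , t) ∈ X) (sym T+d≡Q) (subst (λ t → (m , Q ∸ t) ∈ X) d≡0 (middle-symmetric d∈X))

    lift-rightHalf : lift rightHalf ≡ d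
    lift-rightHalf = trans (cong₂ (λ s t → suc s ∸ t) maxY-rightHalf leftColHeight-rightHalf) (m∸[m∸n]≡n d≤T)

    private
      module G = Glue rightHalf-DCP

      fromGlue : ∀ {z} → G.InGlue z → z ∈ X
      fromGlue {x , y} (inj₂ (p≤x , e≤y , u∈)) rewrite maxX-rightHalf | lift-rightHalf =
        subst₂ (λ s t → (s , t) ∈ X) (m∸n+n≡m p≤x) (m∸n+n≡m e≤y) (proj₂ (∈rightHalf⁻ u∈))
      fromGlue {x , y} (inj₁ (x≤p , y≤q , u∈)) rewrite maxX-rightHalf | maxY-rightHalf =
        subst₂ (λ s t → (s , t) ∈ X) x≡ y≡ (rotate∈ (proj₂ (∈rightHalf⁻ u∈)))
        where
        x≡ : (m + m) ∸ ((m ∸ x) + m) ≡ x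
        x≡ = trans (cong ((m + m) ∸_) (+-comm (m ∸ x) m)) (trans ([m+n]∸[m+o]≡n∸o m m (m ∸ x)) (m∸[m∸n]≡n x≤p))
        y≡ : Q ∸ ((T ∸ y) + d) ≡ y
        y≡ = trans (cong (Q ∸_) (trans (sym (+-∸-comm d y≤q)) (cong (_∸ y) T+d≡Q))) (m∸[m∸n]≡n (≤-trans y≤q (m∸n≤m Q d)))

      toGlue : ∀ {z} → z ∈ X → G.InGlue z
      toGlue {x , y} z∈X with m ≤? x
      ... | yes m≤x = inj₂ (subst (_≤ x) (sym maxX-rightHalf) m≤x , subst (_≤ y) (sym lift-rightHalf) d≤y ,
                            subst₂ (λ s t → (x ∸ s , y ∸ t) ∈ rightHalf) (sym maxX-rightHalf) (sym lift-rightHalf) u∈)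
        where
        d≤y = above z∈X m≤x
        u∈ : (x ∸ m , y ∸ d) ∈ rightHalf
        u∈ = ∈rightHalf⁺ (m≤n+o⇒m∸n≤o x m (x≤2m z∈X)) (subst₂ (λ s t → (s , t) ∈ X) (sym (m∸n+n≡m m≤x)) (sym (m∸n+n≡m d≤y)) z∈X)
      ... | no m≰x = inj₁ (subst (x ≤_) (sym maxX-rightHalf) x≤m , subst (y ≤_) (sym maxY-rightHalf) y≤T ,
                           subst₂ (λ s t → (s ∸ x , t ∸ y) ∈ rightHalf) (sym maxX-rightHalf) (sym maxY-rightHalf) u∈)
        where
        x≤m = <⇒≤ (≰⇒> m≰x)
        2m∸x≡ : (m + m) ∸ x ≡ (m ∸ x) + m
        2m∸x≡ = trans (+-∸-assoc m x≤m) (+-comm m (m ∸ x))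
        d≤Q∸y = above (rotate∈ z∈X) (subst (m ≤_) (sym 2m∸x≡) (m≤n+m m (m ∸ x)))
        y≤T : y ≤ T
        y≤T = m+n≤o⇒m≤o∸n y (subst (_≤ Q) (+-comm d y) (m≤o∸n⇒m+n≤o d (y≤Q z∈X) d≤Q∸y))
        Q∸y≡ : Q ∸ y ≡ (T ∸ y) + d
        Q∸y≡ = trans (cong (_∸ y) (sym T+d≡Q)) (+-∸-comm d y≤T)
        u∈ : (m ∸ x , T ∸ y) ∈ rightHalf
        u∈ = ∈rightHalf⁺ (m∸n≤m m x) (subst₂ (λ s t → (s , t) ∈ X) 2m∸x≡ Q∸y≡ (rotate∈ z∈X))

    glue-rightHalf : glue rightHalf ≡ X
    glue-rightHalf = sorted-set⇒≡ (IsPolyomino.sorted G.glue-polyomino) (IsPolyomino.sorted P)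
      (mk⇔ (fromGlue ∘ G.glue⁻) (G.glue⁺ ∘ toGlue))

    rightHalf-DClass : ∀ {W H A} → FClass W H A X → DClass (suc W) H A rightHalf
    rightHalf-DClass (_ , _ , _ , w≡ , h≡ , a≡) = to IsDCP⇔IsDirectedConvex rightHalf-DCP ,
      from G.glue-sizes⇔ (subst (λ Y → width Y ≡ _ × height Y ≡ _ × area Y ≡ _) (sym glue-rightHalf) (w≡ , h≡ , a≡))

    rightHalf-notFull : 0 < d → ¬ LeftColumnFull rightHalf
    rightHalf-notFull 0<d full =
      <-irrefl (suc-injective (trans (sym leftColHeight-rightHalf) (trans full (cong suc maxY-rightHalf)))) (∸-monoʳ-< 0<d d≤T)

GlueDecomposition : ℕ → ℕ → ℕ → List Cell → Set
GlueDecomposition W H A X =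
  (∃ λ S → DClass (suc W) H A S × glue S ≡ X) ⊎
  (∃ λ S → (DClass (suc W) H A ∩ ∁ LeftColumnFull) S × (reflect ∘ glue) S ≡ X)

FClass-decomposition : ∀ {W H A X} → FClass W H A X → GlueDecomposition W H A X
FClass-decomposition {W} {H} {A} {X} F@((P , cv) , ri , (m , odd) , _) =
  decompose (any? (λ u → (m ≤? proj₁ u) ×-dec (proj₂ u <? d)) X)
  where
  closed = to RotInvariant⇔RotationClosed ri
  maxX≡ : maxX X ≡ m + m
  maxX≡ = trans (suc-injective odd) (cong (m +_) (+-identityʳ m))
  lowest = least (λ y → (m , y) ∈? X) (proj₂ (column-nonempty P m (subst (m ≤_) (sym maxX≡) (m≤m+n m m))))
  d = proj₁ lowest
  d∈X = proj₁ (proj₂ lowest)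
  d-min = proj₂ (proj₂ lowest)
  open MiddleColumn P cv closed maxX≡ d∈X d-min

  decompose : Dec (Any (λ u → m ≤ proj₁ u × proj₂ u < d) X) → GlueDecomposition W H A X
  decompose (no none) = inj₁ (rightHalf , rightHalf-DClass above F , glue-rightHalf above)
    where
    above : RightHalfAbove
    above z∈X m≤x = ≮⇒≥ (λ y<d → none (lose z∈X (m≤x , y<d)))
  decompose (yes some) with (x₁ , y₁) , z₁∈X , m≤x₁ , y₁<d ← find some =
    inj₂ (R.rightHalf , (R.rightHalf-DClass above (Y.reflect-FClass F) , R.rightHalf-notFull above (≤-<-trans z≤n y₁<d)) ,
          trans (cong reflect (R.glue-rightHalf above)) (reflect-involutive P))
    where
    module Y = Reflect P
    d∈Y : (m , d) ∈ Y.Y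
    d∈Y = Y.reflect⁺′ d≤Q (middle-symmetric d∈X)
    d-minY : ∀ {y} → (m , y) ∈ Y.Y → d ≤ y
    d-minY y∈Y with y≤Q , y∈X ← Y.reflect⁻ y∈Y = d-min (subst (λ s → (m , s) ∈ X) (m∸[m∸n]≡n y≤Q) (middle-symmetric y∈X))
    module R = MiddleColumn Y.reflect-polyomino (Y.reflect-convex cv) (Y.reflect-rotationClosed closed)
                            (trans Y.maxX-reflect maxX≡) d∈Y d-minY
    above : R.RightHalfAbove
    above z∈Y m≤x with y≤Q , z∈X ← Y.reflect⁻ z∈Y = ∸-cancelʳ-≤ d≤Q (rightHalf-belowTop z₁∈X m≤x₁ y₁<d z∈X m≤x)

-- The lift of S is the lowest row of the middle column of glue S, and S is then read off the lifted copy.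
glue-injective : ∀ {S S′} → IsDCP S → IsDCP S′ → maxX S ≡ maxX S′ → glue S ≡ glue S′ → S ≡ S′
glue-injective dcp dcp′ p≡ X≡ =
  sorted-set⇒≡ (proj₁ dcp) (proj₁ dcp′) (mk⇔ (into dcp dcp′ p≡ X≡) (into dcp′ dcp (sym p≡) (sym X≡)))
  where
  into : ∀ {S S′} → IsDCP S → IsDCP S′ → maxX S ≡ maxX S′ → glue S ≡ glue S′ → ∀ {c} → c ∈ S → c ∈ S′
  into {S} {S′} dcp dcp′ p≡ X≡ {a , b} c∈S =
    G′.right⁻ (subst₂ (λ s t → (a + s , b + t) ∈ glue S′) p≡ e≡ (subst (_ ∈_) X≡ (G.glue⁺ (G.right c∈S))))
    where
    module G = Glue dcp
    module G′ = Glue dcp′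
    e≡ : lift S ≡ lift S′
    e≡ = ≤-antisym (proj₁ (G.sharedColumn⁻ (G.glue⁻ (subst₂ (λ s Y → (s , lift S′) ∈ Y) (sym p≡) (sym X≡) G′.lowestShared))))
                   (proj₁ (G′.sharedColumn⁻ (G′.glue⁻ (subst₂ (λ s Y → (s , lift S) ∈ Y) p≡ X≡ G.lowestShared))))

glue≢reflect-glue : ∀ {S S′} → IsDCP S → IsDCP S′ → ¬ LeftColumnFull S′ → maxX S ≡ maxX S′ → glue S ≢ reflect (glue S′)
glue≢reflect-glue dcp dcp′ notFull p≡ X≡ =
  Glue.glue-noRightCellBelowMiddle dcp (subst₂ RightCellBelowMiddle (sym p≡) (sym X≡)
    (Reflect.reflect-aboveMiddle⇒belowMiddle (Glue.glue-polyomino dcp′) (Glue.glue-rightCellAboveMiddle dcp′ notFull)))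

DClass-count : ∀ n H A → ∃ (Count (DClass n H A))
DClass-count n H A = _ , count-filter (sublists-unique (Sorted⇒Unique (box-sorted n (H + A)))) (DClass? n H A)
  (λ dc → sorted∈sublists-box (IsPolyomino.sorted (proj₁ (proj₁ (proj₁ dc)))) (DClass⇒inBox dc))

private
  DClass⇒IsDCP : ∀ {n H A S} → DClass n H A S → IsDCP S
  DClass⇒IsDCP dc = from IsDCP⇔IsDirectedConvex (proj₁ dc)

  DClass-maxX-≡ : ∀ {n H A S S′} → DClass n H A S → DClass n H A S′ → maxX S ≡ maxX S′
  DClass-maxX-≡ (_ , 2w≡ , _) (_ , 2w′≡ , _) = suc-injective (*-cancelˡ-≡ _ _ 2 (trans 2w≡ (sym 2w′≡)))

DClass-glue-injective : ∀ {n H A S S′} → DClass n H A S → DClass n H A S′ → glue S ≡ glue S′ → S ≡ S′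
DClass-glue-injective dc dc′ = glue-injective (DClass⇒IsDCP dc) (DClass⇒IsDCP dc′) (DClass-maxX-≡ dc dc′)

DClass-reflect∘glue-injective : ∀ {n H A S S′} → DClass n H A S → DClass n H A S′ →
  reflect (glue S) ≡ reflect (glue S′) → S ≡ S′
DClass-reflect∘glue-injective {S = S} {S′} dc dc′ eq = DClass-glue-injective dc dc′ (begin
  glue S                       ≡⟨ sym (reflect-involutive (Glue.glue-polyomino (DClass⇒IsDCP dc))) ⟩
  reflect (reflect (glue S))   ≡⟨ cong reflect eq ⟩
  reflect (reflect (glue S′))  ≡⟨ reflect-involutive (Glue.glue-polyomino (DClass⇒IsDCP dc′)) ⟩
  glue S′                      ∎)
  where open ≡-Reasoning

DClass-glue≢reflect∘glue : ∀ {n H A S S′} → DClass n H A S → (DClass n H A ∩ ∁ LeftColumnFull) S′ →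
  glue S ≢ reflect (glue S′)
DClass-glue≢reflect∘glue dc (dc′ , notFull) =
  glue≢reflect-glue (DClass⇒IsDCP dc) (DClass⇒IsDCP dc′) notFull (DClass-maxX-≡ dc dc′)

FClass⇔GlueDecomposition : ∀ {W H A} X → FClass W H A X ⇔ GlueDecomposition W H A X
FClass⇔GlueDecomposition X = mk⇔ FClass-decomposition fromImages
  where
  fromImages : ∀ {W H A} → GlueDecomposition W H A X → FClass W H A X
  fromImages (inj₁ (S , dc , refl)) = Glue.glue-FClass (DClass⇒IsDCP dc) dc
  fromImages (inj₂ (S , (dc , _) , refl)) =
    Reflect.reflect-FClass (Glue.glue-polyomino (DClass⇒IsDCP dc)) (Glue.glue-FClass (DClass⇒IsDCP dc) dc)

open import Data.Integer as ℤ using (ℤ; +_)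
open import Data.Integer.Properties using (pos-*; m-n≡m⊖n; ⊖-≥)

2*-minus : ∀ {k n m} → k + n ≡ m → + (m + n) ≡ (+ 2) ℤ.* (+ m) ℤ.- (+ k)
2*-minus {k} {n} {m} k+n≡m = sym (begin
  (+ 2) ℤ.* (+ m) ℤ.- (+ k)   ≡⟨ cong (ℤ._- (+ k)) (sym (pos-* 2 m)) ⟩
  + (2 * m) ℤ.- (+ k)         ≡⟨ m-n≡m⊖n (2 * m) k ⟩
  (2 * m) ℤ.⊖ k               ≡⟨ ⊖-≥ (≤-trans (≤-trans (m≤m+n k n) (≤-reflexive k+n≡m)) (m≤m+n m (m + 0))) ⟩
  + (2 * m ∸ k)               ≡⟨ cong +_ (trans (cong (_∸ k) 2m≡) (m+n∸n≡m (m + n) k)) ⟩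
  + (m + n)                   ∎)
  where
  open ≡-Reasoning
  2m≡ : 2 * m ≡ m + n + k
  2m≡ = trans (cong (λ x → m + x) (trans (+-identityʳ m) (trans (sym k+n≡m) (+-comm k n)))) (sym (+-assoc m n k))

mainTheorem15 : ∀ (W H A : ℕ) →
    Σ ℕ λ nF → Σ ℕ λ nD → Σ ℕ λ nT →
      Count (FClass W H A) nF × Count (DClass (suc W) H A) nD ×
      Count (TClass (suc W) H A) nT ×
      ((+ nF) ≡ ((+ 2) ℤ.* (+ nD)) ℤ.- (+ nT))
mainTheorem15 W H A
  with nD , countD ← DClass-count (suc W) H A
  with nT , nN , countFull , countNotFull , nT+nN≡nD ← count-split (λ S → leftColHeight S ≟ height S) countD =
  nD + nN , nD , nT ,
  count-images glue (reflect ∘ glue) countD countNotFull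
    DClass-glue-injective (λ (dc , _) (dc′ , _) → DClass-reflect∘glue-injective dc dc′) DClass-glue≢reflect∘glue
    FClass⇔GlueDecomposition ,
  countD ,
  count-resp-⇔ (λ _ → DClass∩LeftColumnFull⇔TClass) countFull ,
  2*-minus nT+nN≡nD
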